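{- The set-operad $\mathcal{BWS}$ is isomorphic to the sub-operad of $\mathcal{GR}_4$ generated by the three tridendriform operations $\prec$, $\odot$ and $\succ$.
   Context: $\mathcal{GR}_4$ is the quotient of the free non-symmetric set-operad on binary generators $\prec,\succ,\circ,\odot$ by the operad congruence generated by $(x\succ y)\prec z=x\succ(y\prec z)$, $(x\circ y)\circ z=x\circ(y\circ z)$, $(x\succ y)\circ z=x\succ(y\circ z)$, $(x\prec y)\circ z=x\circ(y\succ z)$, $(x\circ y)\prec z=x\circ(y\prec z)$, $(x\odot y)\odot z=x\odot(y\odot z)$, $(x\prec y)\prec z=x\prec(y\odot z)$, $(x\odot y)\succ z=x\succ(y\succ z)$. A red and white tree of weight $n$: rooted tree with unordered children, each node carrying a (possibly empty) set of labels, label sets disjoint with union $\{1,\dots,n\}$, empty nodes having at least two children; labelled nodes are white, an empty node is red iff all its children are white. Composition $T_1\circ_xT_2$ ($T_2$ of weight $k$, $x$ a label of $T_1$ in node $z$): relabel $y>x$ in $T_1$ as $y+k-1$, add $x-1$ to labels of $T_2$; (W) root of $T_2$ not red: erase $x$ from $z$, add root labels of $T_2$ to $z$, make root's children children of $z$; (R1) root of $T_2$ red and $T_1$ the one-node tree $\{x\}$: result $T_2$; (R2) root of $T_2$ red and $z$ not a leaf or with at least two labels: remove $x$ from $z$, attach root of $T_2$ as child of $z$; (R3) root of $T_2$ red and $z$ a non-root leaf with sole label $x$: delete $z$, make children of root of $T_2$ children of the parent of $z$; $z$ is white if it ends without labels. Unit: one-node tree $\{1\}$. $\mathcal{BWS}$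 is the set-operad of such trees generated by: root $\{2\}$ with child $\{1\}$; root $\{1\}$ with child $\{2\}$; red empty root with leaves $\{1\},\{2\}$. -}

module Defs where

open import Data.Nat using (ℕ; zero; suc; _+_; _∸_; _≤_; _≤ᵇ_; _<ᵇ_; _≡ᵇ_)
open import Data.Bool using (Bool; true; false; not; _∧_; if_then_else_)
open import Data.List using (List; []; _∷_; _++_; map; filterᵇ)
open import Data.Bool.ListAction using (any)
open import Data.Product using (Σ; _×_; ∃)
open import Data.List.Relation.Binary.Permutation.Propositional using (_↭_)

data Op4 : Set where
  prec succ circ odot : Op4

data Tm : Set where
  leaf : Tm
  node : Op4 → Tm → Tm → Tm       -- node o a b  represents  a o b

ar : Tm → ℕ
ar leaf         = 1
ar (node _ a b) = ar a + ar b

-- partial composition  a ∘ᵢ b  (1-based i, grafting b on the i-th leaf of a)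
infixl 6 _∘⟨_⟩_
_∘⟨_⟩_ : Tm → ℕ → Tm → Tm
leaf ∘⟨ zero ⟩ s          = leaf
leaf ∘⟨ suc zero ⟩ s      = s
leaf ∘⟨ suc (suc _) ⟩ s   = leaf
node o a b ∘⟨ i ⟩ s with i ≤ᵇ ar a
... | true  = node o (a ∘⟨ i ⟩ s) b
... | false = node o a (b ∘⟨ i ∸ ar a ⟩ s)

-- the eight defining relations (arity 3, leaves x y z in order)
private
  l : Tm
  l = leaf

data Ax : Tm → Tm → Set where
  r1 : Ax (node prec (node succ l l) l) (node succ l (node prec l l))
  r2 : Ax (node circ (node circ l l) l) (node circ l (node circ l l))
  r3 : Ax (node circ (node succ l l) l) (node succ l (node circ l l))
  r4 : Ax (node circ (node prec l l) l) (node circ l (node succ l l))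
  r5 : Ax (node prec (node circ l l) l) (node circ l (node prec l l))
  r6 : Ax (node odot (node odot l l) l) (node odot l (node odot l l))
  r7 : Ax (node prec (node prec l l) l) (node prec l (node odot l l))
  r8 : Ax (node succ (node odot l l) l) (node succ l (node succ l l))

infix 4 _~_
data _~_ : Tm → Tm → Set where
  ax     : ∀ {s t} → Ax s t → s ~ t
  ~refl  : ∀ {s} → s ~ s
  ~sym   : ∀ {s t} → s ~ t → t ~ s
  ~trans : ∀ {s t u} → s ~ t → t ~ u → s ~ u
  compˡ  : ∀ {a a′ b i} → 1 ≤ i → i ≤ ar a → a ~ a′ → a ∘⟨ i ⟩ b ~ a′ ∘⟨ i ⟩ b
  compʳ  : ∀ {a b b′ i} → 1 ≤ i → i ≤ ar a → b ~ b′ → a ∘⟨ i ⟩ b ~ a ∘⟨ i ⟩ b′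

-- GR₄(n) = { t | ar t ≡ n } / ~ .
data GenG : ℕ → Tm → Set where
  g-unit : GenG 1 leaf
  g-prec : GenG 2 (node prec leaf leaf)
  g-odot : GenG 2 (node odot leaf leaf)
  g-succ : GenG 2 (node succ leaf leaf)
  g-comp : ∀ {m n a b i} → GenG m a → GenG n b → 1 ≤ i → i ≤ m →
           GenG (m + n ∸ 1) (a ∘⟨ i ⟩ b)

SubGR : ℕ → Set
SubGR n = Σ Tm (GenG n)

_≈G_ : ∀ {n} → SubGR n → SubGR n → Set
(a Data.Product., _) ≈G (b Data.Product., _) = a ~ b

-- Part 2. Red and white trees and the operad BWS.
-- A node carries a list of labels (read as a set) and a list of children
-- (read as a multiset); equality of trees is _≈T_ below.

data RW : Set where
  nd : List ℕ → List RW → RW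

labels : RW → List ℕ
labels (nd L _) = L

children : RW → List RW
children (nd _ cs) = cs

mutual
  relabel : (ℕ → ℕ) → RW → RW
  relabel f (nd L cs) = nd (map f L) (relabelF f cs)

  relabelF : (ℕ → ℕ) → List RW → List RW
  relabelF f []       = []
  relabelF f (c ∷ cs) = relabel f c ∷ relabelF f cs

mutual
  weight : RW → ℕ
  weight (nd L cs) = Data.List.length L + weightF cs

  weightF : List RW → ℕ
  weightF []       = 0
  weightF (c ∷ cs) = weight c + weightF cs

-- colours: labelled nodes are white; an empty node is red iff all its
-- children are white.
mutual
  red : RW → Bool
  red (nd [] cs)      = allWhite cs
  red (nd (_ ∷ _) cs) = false

  allWhite : List RW → Bool
  allWhite []       = true
  allWhite (c ∷ cs) = not (red c) ∧ allWhite cs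

_∈ᵇ_ : ℕ → List ℕ → Bool
x ∈ᵇ L = any (_≡ᵇ x) L

remove : ℕ → List ℕ → List ℕ
remove x = filterᵇ (λ y → not (y ≡ᵇ x))

soleLeaf : ℕ → RW → Bool
soleLeaf x (nd (y ∷ []) []) = y ≡ᵇ x
soleLeaf x _                = false

-- case (W): L₂, C₂ = root labels / root children of T₂
mutual
  graftW : ℕ → List ℕ → List RW → RW → RW
  graftW x L₂ C₂ (nd L cs) =
    if x ∈ᵇ L then nd (remove x L ++ L₂) (cs ++ C₂)
              else nd L (graftWF x L₂ C₂ cs)

  graftWF : ℕ → List ℕ → List RW → List RW → List RW
  graftWF x L₂ C₂ []       = []
  graftWF x L₂ C₂ (c ∷ cs) = graftW x L₂ C₂ c ∷ graftWF x L₂ C₂ cs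

-- cases (R2)/(R3): T₂ with red root, C₂ its root children
mutual
  graftR : ℕ → RW → List RW → RW → RW
  graftR x T₂ C₂ (nd L cs) =
    if x ∈ᵇ L then nd (remove x L) (cs ++ T₂ ∷ [])
              else nd L (graftRF x T₂ C₂ cs)

  graftRF : ℕ → RW → List RW → List RW → List RW
  graftRF x T₂ C₂ []       = []
  graftRF x T₂ C₂ (c ∷ cs) =
    if soleLeaf x c then C₂ ++ graftRF x T₂ C₂ cs
                    else graftR x T₂ C₂ c ∷ graftRF x T₂ C₂ cs

compRW : RW → ℕ → RW → RW
compRW T₁ x T₂ =
  if red T₂′
    then (if soleLeaf x T₁′ then T₂′
                            else graftR x T₂′ (children T₂′) T₁′)
    else graftW x (labels T₂′) (children T₂′) T₁′
  where
    k   = weight T₂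
    T₁′ = relabel (λ y → if x <ᵇ y then y + k ∸ 1 else y) T₁
    T₂′ = relabel (λ y → y + (x ∸ 1)) T₂

data _≈T_ : RW → RW → Set
data _≈F_ : List RW → List RW → Set

data _≈T_ where
  nd≈ : ∀ {L L′ cs cs′} → L ↭ L′ → cs ≈F cs′ → nd L cs ≈T nd L′ cs′

data _≈F_ where
  []≈    : [] ≈F []
  ∷≈     : ∀ {t t′ ts ts′} → t ≈T t′ → ts ≈F ts′ → (t ∷ ts) ≈F (t′ ∷ ts′)
  swap≈  : ∀ {t t′ ts} → (t ∷ t′ ∷ ts) ≈F (t′ ∷ t ∷ ts)
  trans≈ : ∀ {ts us vs} → ts ≈F us → us ≈F vs → ts ≈F vs

leafRW : ℕ → RW
leafRW i = nd (i ∷ []) []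

data GenB : ℕ → RW → Set where
  b-unit : GenB 1 (leafRW 1)
  b-gen₁ : GenB 2 (nd (2 ∷ []) (leafRW 1 ∷ []))
  b-gen₂ : GenB 2 (nd (1 ∷ []) (leafRW 2 ∷ []))
  b-gen₃ : GenB 2 (nd [] (leafRW 1 ∷ leafRW 2 ∷ []))
  b-comp : ∀ {m n S T i} → GenB m S → GenB n T → 1 ≤ i → i ≤ m →
           GenB (m + n ∸ 1) (compRW S i T)

BWS : ℕ → Set
BWS n = Σ RW (GenB n)

_≈B_ : ∀ {n} → BWS n → BWS n → Set
(S Data.Product., _) ≈B (T Data.Product., _) = S ≈T T

unitB : BWS 1
unitB = leafRW 1 Data.Product., b-unit

unitG : SubGR 1
unitG = leaf Data.Product., g-unit

compB : ∀ {m n} → BWS m → (i : ℕ) → 1 ≤ i → i ≤ m → BWS n → BWS (m + n ∸ 1)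
compB (S Data.Product., gS) i p q (T Data.Product., gT) =
  compRW S i T Data.Product., b-comp gS gT p q

compG : ∀ {m n} → SubGR m → (i : ℕ) → 1 ≤ i → i ≤ m → SubGR n → SubGR (m + n ∸ 1)
compG (a Data.Product., ga) i p q (b Data.Product., gb) =
  (a ∘⟨ i ⟩ b) Data.Product., g-comp ga gb p q

-- an isomorphism of set-operads (on the quotient sets, i.e. arity-wise
-- bijections of equivalence classes, preserving unit and partial compositions)
record IsOperadIso (φ : ∀ n → BWS n → SubGR n) : Set where
  field
    φ-cong : ∀ n (S T : BWS n) → S ≈B T → φ n S ≈G φ n T
    φ-inj  : ∀ n (S T : BWS n) → φ n S ≈G φ n T → S ≈B T
    φ-surj : ∀ n (a : SubGR n) → ∃ λ (S : BWS n) → φ n S ≈G a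
    φ-unit : φ 1 unitB ≈G unitG
    φ-comp : ∀ m n (i : ℕ) (p : 1 ≤ i) (q : i ≤ m) (S : BWS m) (T : BWS n) →
             φ (m + n ∸ 1) (compB S i p q T) ≈G compG (φ m S) i p q (φ n T)

-- Terms in ≺, ⊙, ≻ are evaluated as red and white trees: x ≺ y hangs the ⊙-factors of y
-- below the root of x, x ≻ y hangs those of x below the root of y, and x ⊙ y puts the
-- factors of both under a new red root.  This evaluation turns partial composition of terms
-- into composition of trees, so a derivation of a tree in BWS names a term evaluating back
-- to that tree.  This is the map φ; it respects units and compositions, and is onto, by
-- construction.
-- Evaluation also identifies the two sides of each ∘-free relation r1, r6, r7, r8, which
-- makes φ injective on classes.  Conversely, reading a tree back into a term by sorting the
-- labels and children of each node by least label yields the normal form of every ∘-free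
-- term that evaluates to the tree, for the rewriting system obtained by orienting those four
-- relations; hence equal trees give related terms.

module Submission where

open import Data.Bool using (Bool; true; false; not; _∧_; if_then_else_)
open import Data.Bool.Properties using (T-≡; ∧-zeroʳ; ∧-assoc)
open import Data.List using (List; []; _∷_; _++_; map; length)
open import Data.List.Properties using (++-assoc; ++-identityʳ; map-++; map-∘; map-id; map-cong-local; length-map; ∷-injective; ≡-dec)
import Data.List.Relation.Binary.Lex.Core as LexCore
import Data.List.Relation.Binary.Lex.NonStrict as Lex
open import Data.List.Relation.Binary.Permutation.Propositional as ↭ using (_↭_; ↭-refl; ↭-sym; ↭-trans; ↭-reflexive; ↭⇒↭ₛ)
open import Data.List.Relation.Binary.Permutation.Propositional.Properties as Perm
  using (↭-length; shifts; ++-comm; All-resp-↭; Any-resp-↭; ¬x∷xs↭[])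
open import Data.List.Relation.Binary.Pointwise using (Pointwise-≡⇒≡)
open import Data.List.Relation.Unary.All as All using (All; []; _∷_)
import Data.List.Relation.Unary.All.Properties as All
import Data.List.Relation.Unary.AllPairs.Properties as AllPairs
open import Data.List.Relation.Unary.Any using (Any; here; there)
open import Data.List.Relation.Unary.Sorted.TotalOrder.Properties using (↗↭↗⇒≋; AllPairs⇒Sorted; Sorted⇒AllPairs)
open import Data.Nat using (ℕ; zero; suc; _+_; _∸_; _⊓_; _≤_; _<_; _≤ᵇ_; _<ᵇ_; _≡ᵇ_; z≤n; s≤s; _≤?_; _<?_; _≟_)
open import Data.Nat.Properties
open import Data.Nat.Tactic.RingSolver using (solve-∀)
open import Data.Product using (Σ; _×_; _,_; proj₁; proj₂)
open import Data.Sum using (_⊎_; inj₁; inj₂)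
open import Data.Unit using (⊤; tt)
open import Function using (Equivalence)
open import Level using (0ℓ)
open import Relation.Binary.Bundles using (DecTotalOrder)
open import Relation.Binary.PropositionalEquality
open import Relation.Nullary using (yes; no; contradiction)
open import Relation.Nullary.Decidable using (map′)

open import Defs

-- Partial composition of terms and the congruence ≋

ar-positive : ∀ t → 1 ≤ ar t
ar-positive leaf         = s≤s z≤n
ar-positive (node _ a b) = ≤-trans (ar-positive a) (m≤m+n (ar a) (ar b))

∘⟨⟩-nodeˡ : ∀ o a b c {i} → i ≤ ar a → node o a b ∘⟨ i ⟩ c ≡ node o (a ∘⟨ i ⟩ c) b
∘⟨⟩-nodeˡ o a b c i≤ rewrite Equivalence.to T-≡ (≤⇒≤ᵇ i≤) = refl

∘⟨⟩-nodeʳ : ∀ o a b c {i} → ar a < i → node o a b ∘⟨ i ⟩ c ≡ node o a (b ∘⟨ i ∸ ar a ⟩ c)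
∘⟨⟩-nodeʳ o a b c {i} ar<i with i ≤ᵇ ar a in e
... | true  = contradiction (≤ᵇ⇒≤ i (ar a) (Equivalence.from T-≡ e)) (<⇒≱ ar<i)
... | false = refl

∘⟨⟩-node-last : ∀ o a b → node o a leaf ∘⟨ ar a + 1 ⟩ b ≡ node o a b
∘⟨⟩-node-last o a b
  rewrite ∘⟨⟩-nodeʳ o a leaf b (subst (ar a <_) (+-comm 1 (ar a)) ≤-refl)
        | m+n∸m≡n (ar a) 1 = refl

+-rightComm : ∀ x y z → x + y + z ≡ x + z + y
+-rightComm = solve-∀

ar-∘⟨⟩ : ∀ a b i → 1 ≤ i → i ≤ ar a → ar (a ∘⟨ i ⟩ b) ≡ ar a + ar b ∸ 1
ar-∘⟨⟩ leaf b (suc zero) _ _ = refl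
ar-∘⟨⟩ leaf b (suc (suc _)) _ (s≤s ())
ar-∘⟨⟩ (node o a₁ a₂) b i 1≤i i≤ with i ≤? ar a₁
... | yes i≤a₁ rewrite ∘⟨⟩-nodeˡ o a₁ a₂ b i≤a₁ | ar-∘⟨⟩ a₁ b i 1≤i i≤a₁
                     | +-∸-assoc (ar a₁) (ar-positive b) | +-∸-assoc (ar a₁ + ar a₂) (ar-positive b)
  = +-rightComm (ar a₁) (ar b ∸ 1) (ar a₂)
... | no i≰a₁ rewrite ∘⟨⟩-nodeʳ o a₁ a₂ b (≰⇒> i≰a₁)
                    | ar-∘⟨⟩ a₂ b (i ∸ ar a₁) (m<n⇒0<n∸m (≰⇒> i≰a₁)) (m≤n+o⇒m∸n≤o i (ar a₁) i≤)
                    | +-assoc (ar a₁) (ar a₂) (ar b)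
  = sym (+-∸-assoc (ar a₁) (≤-trans (ar-positive b) (m≤n+m (ar b) (ar a₂))))

-- Rule o₁ o₂ o₃ o₄ is the relation (x o₂ y) o₁ z = x o₃ (y o₄ z); rule₁ … rule₈ are r1 … r8.
data Rule : Op4 → Op4 → Op4 → Op4 → Set where
  rule₁ : Rule prec succ succ prec
  rule₂ : Rule circ circ circ circ
  rule₃ : Rule circ succ succ circ
  rule₄ : Rule circ prec circ succ
  rule₅ : Rule prec circ circ prec
  rule₆ : Rule odot odot odot odot
  rule₇ : Rule prec prec prec odot
  rule₈ : Rule succ odot succ succ

-- The congruence generated by all substitution instances of the rules.  It coincides
-- with _~_, but unlike _~_ it is defined by structural rules on terms.
infix 4 _≋_
data _≋_ : Tm → Tm → Set where
  rule    : ∀ {o₁ o₂ o₃ o₄} → Rule o₁ o₂ o₃ o₄ → ∀ x y z →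
            node o₁ (node o₂ x y) z ≋ node o₃ x (node o₄ y z)
  ≋-refl  : ∀ {s} → s ≋ s
  ≋-sym   : ∀ {s t} → s ≋ t → t ≋ s
  ≋-trans : ∀ {s t u} → s ≋ t → t ≋ u → s ≋ u
  congˡ   : ∀ {o a a′ b} → a ≋ a′ → node o a b ≋ node o a′ b
  congʳ   : ∀ {o a b b′} → b ≋ b′ → node o a b ≋ node o a b′

ar-≋ : ∀ {a b} → a ≋ b → ar a ≡ ar b
ar-≋ (rule _ x y z)      = +-assoc (ar x) (ar y) (ar z)
ar-≋ ≋-refl              = refl
ar-≋ (≋-sym p)           = sym (ar-≋ p)
ar-≋ (≋-trans p q)       = trans (ar-≋ p) (ar-≋ q)
ar-≋ (congˡ {b = b} p)   = cong (_+ ar b) (ar-≋ p)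
ar-≋ (congʳ {a = a} p)   = cong (ar a +_) (ar-≋ p)

rule-∘⟨⟩ : ∀ {o₁ o₂ o₃ o₄} (r : Rule o₁ o₂ o₃ o₄) x y z c i →
           node o₁ (node o₂ x y) z ∘⟨ i ⟩ c ≋ node o₃ x (node o₄ y z) ∘⟨ i ⟩ c
rule-∘⟨⟩ {o₁} {o₂} {o₃} {o₄} r x y z c i with i ≤? ar x
... | yes i≤x
  rewrite ∘⟨⟩-nodeˡ o₁ (node o₂ x y) z c (≤-trans i≤x (m≤m+n (ar x) (ar y)))
        | ∘⟨⟩-nodeˡ o₂ x y c i≤x | ∘⟨⟩-nodeˡ o₃ x (node o₄ y z) c i≤x
  = rule r _ y z
... | no i≰x with i ≤? ar x + ar y
...   | yes i≤xy
  rewrite ∘⟨⟩-nodeˡ o₁ (node o₂ x y) z c i≤xy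
        | ∘⟨⟩-nodeʳ o₂ x y c (≰⇒> i≰x) | ∘⟨⟩-nodeʳ o₃ x (node o₄ y z) c (≰⇒> i≰x)
        | ∘⟨⟩-nodeˡ o₄ y z c (m≤n+o⇒m∸n≤o i (ar x) i≤xy)
  = rule r x _ z
...   | no i≰xy
  rewrite ∘⟨⟩-nodeʳ o₁ (node o₂ x y) z c (≰⇒> i≰xy)
        | ∘⟨⟩-nodeʳ o₃ x (node o₄ y z) c (≰⇒> i≰x)
        | ∘⟨⟩-nodeʳ o₄ y z c (+-cancelˡ-< (ar x) (ar y) (i ∸ ar x)
                                (subst (ar x + ar y <_) (sym (m+[n∸m]≡n (<⇒≤ (≰⇒> i≰x)))) (≰⇒> i≰xy)))
        | ∸-+-assoc i (ar x) (ar y)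
  = rule r x y _

∘⟨⟩-congˡ-≋ : ∀ {a a′} → a ≋ a′ → ∀ c i → a ∘⟨ i ⟩ c ≋ a′ ∘⟨ i ⟩ c
∘⟨⟩-congˡ-≋ (rule r x y z) c i = rule-∘⟨⟩ r x y z c i
∘⟨⟩-congˡ-≋ ≋-refl c i = ≋-refl
∘⟨⟩-congˡ-≋ (≋-sym p) c i = ≋-sym (∘⟨⟩-congˡ-≋ p c i)
∘⟨⟩-congˡ-≋ (≋-trans p q) c i = ≋-trans (∘⟨⟩-congˡ-≋ p c i) (∘⟨⟩-congˡ-≋ q c i)
∘⟨⟩-congˡ-≋ (congˡ {o} {a} {a′} {b} p) c i with i ≤? ar a
... | yes i≤a rewrite ∘⟨⟩-nodeˡ o a b c i≤a | ∘⟨⟩-nodeˡ o a′ b c (subst (i ≤_) (ar-≋ p) i≤a)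
  = congˡ (∘⟨⟩-congˡ-≋ p c i)
... | no i≰a rewrite ∘⟨⟩-nodeʳ o a b c (≰⇒> i≰a) | ∘⟨⟩-nodeʳ o a′ b c (subst (_< i) (ar-≋ p) (≰⇒> i≰a))
                   | ar-≋ p
  = congˡ p
∘⟨⟩-congˡ-≋ (congʳ {o} {a} {b} {b′} p) c i with i ≤? ar a
... | yes i≤a rewrite ∘⟨⟩-nodeˡ o a b c i≤a | ∘⟨⟩-nodeˡ o a b′ c i≤a = congʳ p
... | no i≰a rewrite ∘⟨⟩-nodeʳ o a b c (≰⇒> i≰a) | ∘⟨⟩-nodeʳ o a b′ c (≰⇒> i≰a)
  = congʳ (∘⟨⟩-congˡ-≋ p c _)

∘⟨⟩-congʳ-≋ : ∀ a {b b′} → b ≋ b′ → ∀ i → a ∘⟨ i ⟩ b ≋ a ∘⟨ i ⟩ b′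
∘⟨⟩-congʳ-≋ leaf p zero          = ≋-refl
∘⟨⟩-congʳ-≋ leaf p (suc zero)    = p
∘⟨⟩-congʳ-≋ leaf p (suc (suc i)) = ≋-refl
∘⟨⟩-congʳ-≋ (node o a₁ a₂) p i with i ≤ᵇ ar a₁
... | true  = congˡ (∘⟨⟩-congʳ-≋ a₁ p i)
... | false = congʳ (∘⟨⟩-congʳ-≋ a₂ p _)

Ax⇒≋ : ∀ {s t} → Ax s t → s ≋ t
Ax⇒≋ r1 = rule rule₁ leaf leaf leaf
Ax⇒≋ r2 = rule rule₂ leaf leaf leaf
Ax⇒≋ r3 = rule rule₃ leaf leaf leaf
Ax⇒≋ r4 = rule rule₄ leaf leaf leaf
Ax⇒≋ r5 = rule rule₅ leaf leaf leaf
Ax⇒≋ r6 = rule rule₆ leaf leaf leaf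
Ax⇒≋ r7 = rule rule₇ leaf leaf leaf
Ax⇒≋ r8 = rule rule₈ leaf leaf leaf

~⇒≋ : ∀ {s t} → s ~ t → s ≋ t
~⇒≋ (ax r)                   = Ax⇒≋ r
~⇒≋ ~refl                    = ≋-refl
~⇒≋ (~sym p)                 = ≋-sym (~⇒≋ p)
~⇒≋ (~trans p q)             = ≋-trans (~⇒≋ p) (~⇒≋ q)
~⇒≋ (compˡ _ _ p)            = ∘⟨⟩-congˡ-≋ (~⇒≋ p) _ _
~⇒≋ (compʳ {a = a} _ _ p)    = ∘⟨⟩-congʳ-≋ a (~⇒≋ p) _

Rule⇒Ax : ∀ {o₁ o₂ o₃ o₄} → Rule o₁ o₂ o₃ o₄ →
          Ax (node o₁ (node o₂ leaf leaf) leaf) (node o₃ leaf (node o₄ leaf leaf))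
Rule⇒Ax rule₁ = r1
Rule⇒Ax rule₂ = r2
Rule⇒Ax rule₃ = r3
Rule⇒Ax rule₄ = r4
Rule⇒Ax rule₅ = r5
Rule⇒Ax rule₆ = r6
Rule⇒Ax rule₇ = r7
Rule⇒Ax rule₈ = r8

~-congˡ : ∀ {o a a′} b → a ~ a′ → node o a b ~ node o a′ b
~-congˡ {o} b = compʳ {a = node o leaf b} {i = 1} (s≤s z≤n) (s≤s z≤n)

~-congʳ : ∀ {o b b′} a → b ~ b′ → node o a b ~ node o a b′
~-congʳ {o} {b} {b′} a p = subst₂ _~_ (∘⟨⟩-node-last o a b) (∘⟨⟩-node-last o a b′)
  (compʳ {a = node o a leaf} (≤-trans (ar-positive a) (m≤m+n (ar a) 1)) ≤-refl p)

~-rule : ∀ {o₁ o₂ o₃ o₄} → Rule o₁ o₂ o₃ o₄ → ∀ x y z →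
         node o₁ (node o₂ x y) z ~ node o₃ x (node o₄ y z)
~-rule r x y z = compˡ {i = 1} (s≤s z≤n) (s≤s z≤n)
                   (compˡ {i = 2} (s≤s z≤n) (m≤m+n 2 (ar z))
                     (compˡ {i = 3} (s≤s z≤n) ≤-refl (ax (Rule⇒Ax r))))

≋⇒~ : ∀ {s t} → s ≋ t → s ~ t
≋⇒~ (rule r x y z)       = ~-rule r x y z
≋⇒~ ≋-refl               = ~refl
≋⇒~ (≋-sym p)            = ~sym (≋⇒~ p)
≋⇒~ (≋-trans p q)        = ~trans (≋⇒~ p) (≋⇒~ q)
≋⇒~ (congˡ {b = b} p)    = ~-congˡ b (≋⇒~ p)
≋⇒~ (congʳ {a = a} p)    = ~-congʳ a (≋⇒~ p)

-- Normal forms orient r1, r6, r7 and r8 from left to right: ⊙ and ≻ nest to the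
-- right, and no ≺ has a ≺ or ≻ as its left argument.
infixr 6 _⊙ₙ_ _≻ₙ_ _≺ₙ_

_⊙ₙ_ : Tm → Tm → Tm
node odot x₁ x₂ ⊙ₙ z = node odot x₁ (x₂ ⊙ₙ z)
x               ⊙ₙ z = node odot x z

_≻ₙ_ : Tm → Tm → Tm
node odot x₁ x₂ ≻ₙ z = node succ x₁ (x₂ ≻ₙ z)
x               ≻ₙ z = node succ x z

_≺ₙ_ : Tm → Tm → Tm
node succ x₁ x₂ ≺ₙ z = node succ x₁ (x₂ ≺ₙ z)
node prec x₁ x₂ ≺ₙ z = node prec x₁ (x₂ ⊙ₙ z)
x               ≺ₙ z = node prec x z

opₙ : Op4 → Tm → Tm → Tm
opₙ prec = _≺ₙ_
opₙ succ = _≻ₙ_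
opₙ odot = _⊙ₙ_
opₙ circ = node circ

normalise : Tm → Tm
normalise leaf         = leaf
normalise (node o a b) = opₙ o (normalise a) (normalise b)

⊙ₙ-assoc : ∀ x y z → (x ⊙ₙ y) ⊙ₙ z ≡ x ⊙ₙ (y ⊙ₙ z)
⊙ₙ-assoc leaf              y z = refl
⊙ₙ-assoc (node prec _ _)   y z = refl
⊙ₙ-assoc (node succ _ _)   y z = refl
⊙ₙ-assoc (node circ _ _)   y z = refl
⊙ₙ-assoc (node odot x₁ x₂) y z = cong (node odot x₁) (⊙ₙ-assoc x₂ y z)

⊙ₙ-≻ₙ : ∀ x y z → (x ⊙ₙ y) ≻ₙ z ≡ x ≻ₙ (y ≻ₙ z)
⊙ₙ-≻ₙ leaf              y z = refl
⊙ₙ-≻ₙ (node prec _ _)   y z = refl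
⊙ₙ-≻ₙ (node succ _ _)   y z = refl
⊙ₙ-≻ₙ (node circ _ _)   y z = refl
⊙ₙ-≻ₙ (node odot x₁ x₂) y z = cong (node succ x₁) (⊙ₙ-≻ₙ x₂ y z)

≺ₙ-≺ₙ : ∀ x y z → (x ≺ₙ y) ≺ₙ z ≡ x ≺ₙ (y ⊙ₙ z)
≺ₙ-≺ₙ leaf              y z = refl
≺ₙ-≺ₙ (node prec x₁ x₂) y z = cong (node prec x₁) (⊙ₙ-assoc x₂ y z)
≺ₙ-≺ₙ (node succ x₁ x₂) y z = cong (node succ x₁) (≺ₙ-≺ₙ x₂ y z)
≺ₙ-≺ₙ (node circ _ _)   y z = refl
≺ₙ-≺ₙ (node odot _ _)   y z = refl

≻ₙ-≺ₙ : ∀ x y z → (x ≻ₙ y) ≺ₙ z ≡ x ≻ₙ (y ≺ₙ z)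
≻ₙ-≺ₙ leaf              y z = refl
≻ₙ-≺ₙ (node prec _ _)   y z = refl
≻ₙ-≺ₙ (node succ _ _)   y z = refl
≻ₙ-≺ₙ (node circ _ _)   y z = refl
≻ₙ-≺ₙ (node odot x₁ x₂) y z = cong (node succ x₁) (≻ₙ-≺ₙ x₂ y z)

⊙-≋-⊙ₙ : ∀ x y → node odot x y ≋ x ⊙ₙ y
⊙-≋-⊙ₙ leaf              y = ≋-refl
⊙-≋-⊙ₙ (node prec _ _)   y = ≋-refl
⊙-≋-⊙ₙ (node succ _ _)   y = ≋-refl
⊙-≋-⊙ₙ (node circ _ _)   y = ≋-refl
⊙-≋-⊙ₙ (node odot x₁ x₂) y = ≋-trans (rule rule₆ x₁ x₂ y) (congʳ (⊙-≋-⊙ₙ x₂ y))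

≻-≋-≻ₙ : ∀ x y → node succ x y ≋ x ≻ₙ y
≻-≋-≻ₙ leaf              y = ≋-refl
≻-≋-≻ₙ (node prec _ _)   y = ≋-refl
≻-≋-≻ₙ (node succ _ _)   y = ≋-refl
≻-≋-≻ₙ (node circ _ _)   y = ≋-refl
≻-≋-≻ₙ (node odot x₁ x₂) y = ≋-trans (rule rule₈ x₁ x₂ y) (congʳ (≻-≋-≻ₙ x₂ y))

≺-≋-≺ₙ : ∀ x y → node prec x y ≋ x ≺ₙ y
≺-≋-≺ₙ leaf              y = ≋-refl
≺-≋-≺ₙ (node prec x₁ x₂) y = ≋-trans (rule rule₇ x₁ x₂ y) (congʳ (⊙-≋-⊙ₙ x₂ y))
≺-≋-≺ₙ (node succ x₁ x₂) y = ≋-trans (rule rule₁ x₁ x₂ y) (congʳ (≺-≋-≺ₙ x₂ y))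
≺-≋-≺ₙ (node circ _ _)   y = ≋-refl
≺-≋-≺ₙ (node odot _ _)   y = ≋-refl

node-≋-opₙ : ∀ o x y → node o x y ≋ opₙ o x y
node-≋-opₙ prec = ≺-≋-≺ₙ
node-≋-opₙ succ = ≻-≋-≻ₙ
node-≋-opₙ odot = ⊙-≋-⊙ₙ
node-≋-opₙ circ x y = ≋-refl

≋-normalise : ∀ a → a ≋ normalise a
≋-normalise leaf         = ≋-refl
≋-normalise (node o a b) =
  ≋-trans (congˡ (≋-normalise a)) (≋-trans (congʳ (≋-normalise b)) (node-≋-opₙ o _ _))

normalise-≡⇒≋ : ∀ {a b} → normalise a ≡ normalise b → a ≋ b
normalise-≡⇒≋ {a} {b} e = ≋-trans (≋-normalise a) (≋-trans (subst (normalise a ≋_) e ≋-refl) (≋-sym (≋-normalise b)))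

circFree : Tm → Bool
circFree leaf            = true
circFree (node circ _ _) = false
circFree (node prec a b) = circFree a ∧ circFree b
circFree (node succ a b) = circFree a ∧ circFree b
circFree (node odot a b) = circFree a ∧ circFree b

circFreeˡ : ∀ o a b → circFree (node o a b) ≡ true → circFree a ≡ true
circFreeˡ prec a b h with circFree a
... | true = refl
circFreeˡ succ a b h with circFree a
... | true = refl
circFreeˡ odot a b h with circFree a
... | true = refl

circFreeʳ : ∀ o a b → circFree (node o a b) ≡ true → circFree b ≡ true
circFreeʳ prec a b h with circFree a
... | true = h
circFreeʳ succ a b h with circFree a
... | true = h
circFreeʳ odot a b h with circFree a
... | true = h

circFree⇒≢circ : ∀ {o a b} → circFree (node o a b) ≡ true → o ≢ circ
circFree⇒≢circ {prec} _ ()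
circFree⇒≢circ {succ} _ ()
circFree⇒≢circ {odot} _ ()

circFree-node : ∀ o {a b} → o ≢ circ → circFree a ≡ true → circFree b ≡ true → circFree (node o a b) ≡ true
circFree-node prec _ p q rewrite p | q = refl
circFree-node succ _ p q rewrite p | q = refl
circFree-node odot _ p q rewrite p | q = refl
circFree-node circ o≢circ _ _ = contradiction refl o≢circ

circFree-∘⟨⟩ : ∀ a b i → circFree a ≡ true → circFree b ≡ true → circFree (a ∘⟨ i ⟩ b) ≡ true
circFree-∘⟨⟩ leaf b zero          _ _ = refl
circFree-∘⟨⟩ leaf b (suc zero)    _ hb = hb
circFree-∘⟨⟩ leaf b (suc (suc _)) _ _ = refl
circFree-∘⟨⟩ (node o a₁ a₂) b i ha hb with i ≤ᵇ ar a₁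
... | true  = circFree-node o (circFree⇒≢circ ha) (circFree-∘⟨⟩ a₁ b i (circFreeˡ o a₁ a₂ ha) hb) (circFreeʳ o a₁ a₂ ha)
... | false = circFree-node o (circFree⇒≢circ ha) (circFreeˡ o a₁ a₂ ha) (circFree-∘⟨⟩ a₂ b _ (circFreeʳ o a₁ a₂ ha) hb)

circFree-node-cong : ∀ o {a a′ b b′} → circFree a ≡ circFree a′ → circFree b ≡ circFree b′ →
                     circFree (node o a b) ≡ circFree (node o a′ b′)
circFree-node-cong prec p q rewrite p | q = refl
circFree-node-cong succ p q rewrite p | q = refl
circFree-node-cong odot p q rewrite p | q = refl
circFree-node-cong circ p q = refl

circFree-≋ : ∀ {a b} → a ≋ b → circFree a ≡ circFree b
circFree-≋ (rule rule₁ x y z) = ∧-assoc (circFree x) (circFree y) (circFree z)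
circFree-≋ (rule rule₂ x y z) = refl
circFree-≋ (rule rule₃ x y z) = sym (∧-zeroʳ (circFree x))
circFree-≋ (rule rule₄ x y z) = refl
circFree-≋ (rule rule₅ x y z) = refl
circFree-≋ (rule rule₆ x y z) = ∧-assoc (circFree x) (circFree y) (circFree z)
circFree-≋ (rule rule₇ x y z) = ∧-assoc (circFree x) (circFree y) (circFree z)
circFree-≋ (rule rule₈ x y z) = ∧-assoc (circFree x) (circFree y) (circFree z)
circFree-≋ ≋-refl             = refl
circFree-≋ (≋-sym p)          = sym (circFree-≋ p)
circFree-≋ (≋-trans p q)      = trans (circFree-≋ p) (circFree-≋ q)
circFree-≋ (congˡ {o} p)      = circFree-node-cong o (circFree-≋ p) refl
circFree-≋ (congʳ {o} p)      = circFree-node-cong o refl (circFree-≋ p)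

-- Relabelling red and white trees

relabelF-++ : ∀ f xs ys → relabelF f (xs ++ ys) ≡ relabelF f xs ++ relabelF f ys
relabelF-++ f []       ys = refl
relabelF-++ f (x ∷ xs) ys = cong (relabel f x ∷_) (relabelF-++ f xs ys)

allWhite-++ : ∀ xs ys → allWhite (xs ++ ys) ≡ allWhite xs ∧ allWhite ys
allWhite-++ []       ys = refl
allWhite-++ (x ∷ xs) ys = trans (cong (not (red x) ∧_) (allWhite-++ xs ys))
                                (sym (∧-assoc (not (red x)) (allWhite xs) (allWhite ys)))

mutual
  red-relabel : ∀ f t → red (relabel f t) ≡ red t
  red-relabel f (nd []      cs) = allWhite-relabel f cs
  red-relabel f (nd (_ ∷ _) cs) = refl

  allWhite-relabel : ∀ f cs → allWhite (relabelF f cs) ≡ allWhite cs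
  allWhite-relabel f []       = refl
  allWhite-relabel f (c ∷ cs) = cong₂ (λ r w → not r ∧ w) (red-relabel f c) (allWhite-relabel f cs)

nd-η : ∀ t → nd (labels t) (children t) ≡ t
nd-η (nd _ _) = refl

labels-relabel : ∀ f t → labels (relabel f t) ≡ map f (labels t)
labels-relabel f (nd L cs) = refl

children-relabel : ∀ f t → children (relabel f t) ≡ relabelF f (children t)
children-relabel f (nd L cs) = refl

mutual
  relabel-∘ : ∀ f g t → relabel f (relabel g t) ≡ relabel (λ y → f (g y)) t
  relabel-∘ f g (nd L cs) = cong₂ nd (sym (map-∘ L)) (relabelF-∘ f g cs)

  relabelF-∘ : ∀ f g cs → relabelF f (relabelF g cs) ≡ relabelF (λ y → f (g y)) cs
  relabelF-∘ f g []       = refl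
  relabelF-∘ f g (c ∷ cs) = cong₂ _∷_ (relabel-∘ f g c) (relabelF-∘ f g cs)

mutual
  AllLabels : (ℕ → Set) → RW → Set
  AllLabels P (nd L cs) = All P L × AllLabelsF P cs

  AllLabelsF : (ℕ → Set) → List RW → Set
  AllLabelsF P []       = ⊤
  AllLabelsF P (c ∷ cs) = AllLabels P c × AllLabelsF P cs

mutual
  AllLabels-map : ∀ {P Q : ℕ → Set} → (∀ {y} → P y → Q y) → ∀ t → AllLabels P t → AllLabels Q t
  AllLabels-map f (nd L cs) (p , q) = All.map f p , AllLabelsF-map f cs q

  AllLabelsF-map : ∀ {P Q : ℕ → Set} → (∀ {y} → P y → Q y) → ∀ cs → AllLabelsF P cs → AllLabelsF Q cs
  AllLabelsF-map f []       tt      = tt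
  AllLabelsF-map f (c ∷ cs) (p , q) = AllLabels-map f c p , AllLabelsF-map f cs q

mutual
  AllLabels-universal : ∀ {P : ℕ → Set} → (∀ y → P y) → ∀ t → AllLabels P t
  AllLabels-universal h (nd L cs) = All.universal h L , AllLabelsF-universal h cs

  AllLabelsF-universal : ∀ {P : ℕ → Set} → (∀ y → P y) → ∀ cs → AllLabelsF P cs
  AllLabelsF-universal h []       = tt
  AllLabelsF-universal h (c ∷ cs) = AllLabels-universal h c , AllLabelsF-universal h cs

AllLabelsF-++ : ∀ {P} xs ys → AllLabelsF P xs → AllLabelsF P ys → AllLabelsF P (xs ++ ys)
AllLabelsF-++ []       ys p        q = q
AllLabelsF-++ (x ∷ xs) ys (p , ps) q = p , AllLabelsF-++ xs ys ps q

mutual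
  AllLabels-relabel : ∀ {P : ℕ → Set} f t → AllLabels (λ y → P (f y)) t → AllLabels P (relabel f t)
  AllLabels-relabel f (nd L cs) (p , q) = All.map⁺ p , AllLabelsF-relabel f cs q

  AllLabelsF-relabel : ∀ {P : ℕ → Set} f cs → AllLabelsF (λ y → P (f y)) cs → AllLabelsF P (relabelF f cs)
  AllLabelsF-relabel f []       tt      = tt
  AllLabelsF-relabel f (c ∷ cs) (p , q) = AllLabels-relabel f c p , AllLabelsF-relabel f cs q

mutual
  relabel-cong : ∀ {f g} t → AllLabels (λ y → f y ≡ g y) t → relabel f t ≡ relabel g t
  relabel-cong (nd L cs) (p , q) = cong₂ nd (map-cong-local p) (relabelF-cong cs q)

  relabelF-cong : ∀ {f g} cs → AllLabelsF (λ y → f y ≡ g y) cs → relabelF f cs ≡ relabelF g cs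
  relabelF-cong []       tt      = refl
  relabelF-cong (c ∷ cs) (p , q) = cong₂ _∷_ (relabel-cong c p) (relabelF-cong cs q)

mutual
  relabel-identity : ∀ {f} t → AllLabels (λ y → f y ≡ y) t → relabel f t ≡ t
  relabel-identity (nd L cs) (p , q) = cong₂ nd (trans (map-cong-local p) (map-id L)) (relabelF-identity cs q)

  relabelF-identity : ∀ {f} cs → AllLabelsF (λ y → f y ≡ y) cs → relabelF f cs ≡ cs
  relabelF-identity []       tt      = refl
  relabelF-identity (c ∷ cs) (p , q) = cong₂ _∷_ (relabel-identity c p) (relabelF-identity cs q)

mutual
  weight-relabel : ∀ f t → weight (relabel f t) ≡ weight t
  weight-relabel f (nd L cs) = cong₂ _+_ (length-map f L) (weightF-relabel f cs)

  weightF-relabel : ∀ f cs → weightF (relabelF f cs) ≡ weightF cs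
  weightF-relabel f []       = refl
  weightF-relabel f (c ∷ cs) = cong₂ _+_ (weight-relabel f c) (weightF-relabel f cs)

weightF-++ : ∀ xs ys → weightF (xs ++ ys) ≡ weightF xs + weightF ys
weightF-++ []       ys = refl
weightF-++ (x ∷ xs) ys = trans (cong (weight x +_) (weightF-++ xs ys)) (sym (+-assoc (weight x) _ _))

-- Evaluating terms as trees

factors : RW → List RW
factors t = if red t then children t else t ∷ []

hang : RW → List RW → RW
hang X E = if red X then nd [] (E ++ X ∷ []) else nd (labels X) (E ++ children X)

join : RW → RW → RW
join A Y = nd [] (factors A ++ factors Y)

-- ∘ is interpreted like ⊙; this is harmless, as only circ-free terms are ever evaluated.
evOp : Op4 → RW → RW → RW
evOp prec A Y = hang A (factors Y)
evOp succ A Y = hang Y (factors A)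
evOp odot A Y = join A Y
evOp circ A Y = join A Y

shift : ℕ → RW → RW
shift w = relabel (λ y → y + w)

toTree : Tm → RW
toTree leaf         = leafRW 1
toTree (node o a b) = evOp o (toTree a) (shift (ar a) (toTree b))

factors-relabel : ∀ f t → factors (relabel f t) ≡ relabelF f (factors t)
factors-relabel f t rewrite red-relabel f t with red t
factors-relabel f (nd L cs) | true  = refl
factors-relabel f (nd L cs) | false = refl

hang-relabel : ∀ f X E → relabel f (hang X E) ≡ hang (relabel f X) (relabelF f E)
hang-relabel f X E rewrite red-relabel f X with red X
hang-relabel f (nd L cs) E | true  = cong (nd []) (relabelF-++ f E _)
hang-relabel f (nd L cs) E | false = cong (nd (map f L)) (relabelF-++ f E cs)

join-relabel : ∀ f A Y → relabel f (join A Y) ≡ join (relabel f A) (relabel f Y)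
join-relabel f A Y rewrite relabelF-++ f (factors A) (factors Y)
                         | factors-relabel f A | factors-relabel f Y = refl

evOp-relabel : ∀ o f A Y → relabel f (evOp o A Y) ≡ evOp o (relabel f A) (relabel f Y)
evOp-relabel prec f A Y rewrite hang-relabel f A (factors Y) | factors-relabel f Y = refl
evOp-relabel succ f A Y rewrite hang-relabel f Y (factors A) | factors-relabel f A = refl
evOp-relabel odot f A Y = join-relabel f A Y
evOp-relabel circ f A Y = join-relabel f A Y

shift-zero : ∀ t → shift 0 t ≡ t
shift-zero t = relabel-identity t (AllLabels-universal +-identityʳ t)

shift-shift : ∀ a b t → shift a (shift b t) ≡ shift (a + b) t
shift-shift a b t = trans (relabel-∘ (λ y → y + a) (λ y → y + b) t)
  (relabel-cong t (AllLabels-universal (λ y → trans (+-assoc y b a) (cong (y +_) (+-comm b a))) t))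

AllLabelsF-factors : ∀ {P} t → AllLabels P t → AllLabelsF P (factors t)
AllLabelsF-factors t p with red t
AllLabelsF-factors (nd L cs) (p , q) | true  = q
AllLabelsF-factors (nd L cs) (p , q) | false = (p , q) , tt

AllLabels-hang : ∀ {P} X E → AllLabels P X → AllLabelsF P E → AllLabels P (hang X E)
AllLabels-hang X E x e with red X
AllLabels-hang (nd L cs) E x       e | true  = [] , AllLabelsF-++ E (nd L cs ∷ []) e (x , tt)
AllLabels-hang (nd L cs) E (p , q) e | false = p , AllLabelsF-++ E cs e q

AllLabels-evOp : ∀ {P} o A Y → AllLabels P A → AllLabels P Y → AllLabels P (evOp o A Y)
AllLabels-evOp prec A Y a y = AllLabels-hang A (factors Y) a (AllLabelsF-factors Y y)
AllLabels-evOp succ A Y a y = AllLabels-hang Y (factors A) y (AllLabelsF-factors A a)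
AllLabels-evOp odot A Y a y = [] , AllLabelsF-++ (factors A) (factors Y) (AllLabelsF-factors A a) (AllLabelsF-factors Y y)
AllLabels-evOp circ A Y a y = [] , AllLabelsF-++ (factors A) (factors Y) (AllLabelsF-factors A a) (AllLabelsF-factors Y y)

InRange : ℕ → ℕ → Set
InRange n y = 1 ≤ y × y ≤ n

toTree-inRange : ∀ a → AllLabels (InRange (ar a)) (toTree a)
toTree-inRange leaf         = (s≤s z≤n , s≤s z≤n) ∷ [] , tt
toTree-inRange (node o a b) = AllLabels-evOp o (toTree a) (shift (ar a) (toTree b))
  (AllLabels-map (λ (1≤y , y≤a) → 1≤y , ≤-trans y≤a (m≤m+n (ar a) (ar b))) (toTree a) (toTree-inRange a))
  (AllLabels-relabel (λ y → y + ar a) (toTree b)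
    (AllLabels-map (λ {y} (1≤y , y≤b) → ≤-trans 1≤y (m≤m+n y (ar a)) ,
                                          subst (y + ar a ≤_) (+-comm (ar b) (ar a)) (+-monoˡ-≤ (ar a) y≤b))
                   (toTree b) (toTree-inRange b)))

positive : ∀ a → AllLabels (1 ≤_) (toTree a)
positive a = AllLabels-map proj₁ (toTree a) (toTree-inRange a)

bounded : ∀ a → AllLabels (_≤ ar a) (toTree a)
bounded a = AllLabels-map proj₂ (toTree a) (toTree-inRange a)

weightF-factors : ∀ t → weightF (factors t) ≡ weight t
weightF-factors (nd [] cs) with allWhite cs
... | true  = refl
... | false = +-identityʳ _
weightF-factors (nd (_ ∷ _) cs) = +-identityʳ _

weight-hang : ∀ X E → weight (hang X E) ≡ weight X + weightF E
weight-hang (nd [] cs) E with allWhite cs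
... | true  rewrite weightF-++ E (nd [] cs ∷ []) | +-identityʳ (weightF cs) = +-comm (weightF E) _
... | false rewrite weightF-++ E cs = +-comm (weightF E) _
weight-hang (nd L@(_ ∷ _) cs) E rewrite weightF-++ E cs = rearrange (length L) (weightF E) (weightF cs)
  where rearrange : ∀ l e c → l + (e + c) ≡ l + c + e
        rearrange = solve-∀

weight-evOp : ∀ o A Y → weight (evOp o A Y) ≡ weight A + weight Y
weight-evOp prec A Y rewrite weight-hang A (factors Y) | weightF-factors Y = refl
weight-evOp succ A Y rewrite weight-hang Y (factors A) | weightF-factors A = +-comm (weight Y) _
weight-evOp odot A Y rewrite weightF-++ (factors A) (factors Y) | weightF-factors A | weightF-factors Y = refl
weight-evOp circ A Y rewrite weightF-++ (factors A) (factors Y) | weightF-factors A | weightF-factors Y = refl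

weight-toTree : ∀ a → weight (toTree a) ≡ ar a
weight-toTree leaf         = refl
weight-toTree (node o a b) rewrite weight-evOp o (toTree a) (shift (ar a) (toTree b))
  | weight-relabel (λ y → y + ar a) (toTree b) | weight-toTree a | weight-toTree b = refl

NonEmpty : {A : Set} → List A → Set
NonEmpty xs = xs ≢ []

++-nonEmpty : ∀ {A : Set} (xs ys : List A) → NonEmpty xs → NonEmpty (xs ++ ys)
++-nonEmpty []       ys ne = contradiction refl ne
++-nonEmpty (x ∷ xs) ys ne = λ ()

factors-nonEmpty : ∀ t → NonEmpty (children t) → NonEmpty (factors t)
factors-nonEmpty t ne with red t
factors-nonEmpty (nd L cs) ne | true  = ne
factors-nonEmpty (nd L cs) ne | false = λ ()

children-hang-nonEmpty : ∀ X E → NonEmpty E → NonEmpty (children (hang X E))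
children-hang-nonEmpty X E ne with red X
... | true  = ++-nonEmpty E _ ne
... | false = ++-nonEmpty E (children X) ne

factors-evOp-nonEmpty : ∀ o A Y → NonEmpty (factors A) → NonEmpty (factors Y) →
                        NonEmpty (factors (evOp o A Y))
factors-evOp-nonEmpty prec A Y a y = factors-nonEmpty (hang A (factors Y)) (children-hang-nonEmpty A (factors Y) y)
factors-evOp-nonEmpty succ A Y a y = factors-nonEmpty (hang Y (factors A)) (children-hang-nonEmpty Y (factors A) a)
factors-evOp-nonEmpty odot A Y a y = factors-nonEmpty (join A Y) (++-nonEmpty (factors A) (factors Y) a)
factors-evOp-nonEmpty circ A Y a y = factors-nonEmpty (join A Y) (++-nonEmpty (factors A) (factors Y) a)

factors-relabel-nonEmpty : ∀ f t → NonEmpty (factors t) → NonEmpty (factors (relabel f t))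
factors-relabel-nonEmpty f t ne rewrite factors-relabel f t with factors t
... | []    = contradiction refl ne
... | _ ∷ _ = λ ()

factors-toTree-nonEmpty : ∀ a → NonEmpty (factors (toTree a))
factors-toTree-nonEmpty leaf         = λ ()
factors-toTree-nonEmpty (node o a b) =
  factors-evOp-nonEmpty o (toTree a) (shift (ar a) (toTree b)) (factors-toTree-nonEmpty a)
    (factors-relabel-nonEmpty _ (toTree b) (factors-toTree-nonEmpty b))

-- Grafting

Avoids : ℕ → RW → Set
Avoids x = AllLabels (_≢ x)

AvoidsF : ℕ → List RW → Set
AvoidsF x = AllLabelsF (_≢ x)

≢⇒≡ᵇ-false : ∀ {y x} → y ≢ x → (y ≡ᵇ x) ≡ false
≢⇒≡ᵇ-false {y} {x} y≢x with y ≡ᵇ x in e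
... | true  = contradiction (≡ᵇ⇒≡ y x (Equivalence.from T-≡ e)) y≢x
... | false = refl

∈ᵇ-false : ∀ {x L} → All (_≢ x) L → (x ∈ᵇ L) ≡ false
∈ᵇ-false []       = refl
∈ᵇ-false (p ∷ ps) rewrite ≢⇒≡ᵇ-false p = ∈ᵇ-false ps

soleLeaf-false : ∀ {x L} cs → All (_≢ x) L → soleLeaf x (nd L cs) ≡ false
soleLeaf-false {L = []}         cs       _        = refl
soleLeaf-false {L = _ ∷ []}     []       (p ∷ []) = ≢⇒≡ᵇ-false p
soleLeaf-false {L = _ ∷ []}     (_ ∷ _)  _        = refl
soleLeaf-false {L = _ ∷ _ ∷ _}  cs       _        = refl

soleLeaf-avoids : ∀ {x} t → Avoids x t → soleLeaf x t ≡ false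
soleLeaf-avoids (nd L cs) (p , _) = soleLeaf-false cs p

soleLeaf⇒white : ∀ x t → soleLeaf x t ≡ true → red t ≡ false
soleLeaf⇒white x (nd (_ ∷ []) []) _ = refl

module Graft (x : ℕ) where

  mutual
    graftW-id : ∀ LB CB t → Avoids x t → graftW x LB CB t ≡ t
    graftW-id LB CB (nd L cs) (p , q) rewrite ∈ᵇ-false p = cong (nd L) (graftWF-id LB CB cs q)

    graftWF-id : ∀ LB CB cs → AvoidsF x cs → graftWF x LB CB cs ≡ cs
    graftWF-id LB CB []       tt      = refl
    graftWF-id LB CB (c ∷ cs) (p , q) = cong₂ _∷_ (graftW-id LB CB c p) (graftWF-id LB CB cs q)

  mutual
    graftR-id : ∀ B C t → Avoids x t → graftR x B C t ≡ t
    graftR-id B C (nd L cs) (p , q) rewrite ∈ᵇ-false p = cong (nd L) (graftRF-id B C cs q)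

    graftRF-id : ∀ B C cs → AvoidsF x cs → graftRF x B C cs ≡ cs
    graftRF-id B C []       tt      = refl
    graftRF-id B C (c ∷ cs) (p , q) rewrite soleLeaf-avoids c p =
      cong₂ _∷_ (graftR-id B C c p) (graftRF-id B C cs q)

  graftWF-++ : ∀ LB CB xs ys → graftWF x LB CB (xs ++ ys) ≡ graftWF x LB CB xs ++ graftWF x LB CB ys
  graftWF-++ LB CB []       ys = refl
  graftWF-++ LB CB (c ∷ xs) ys = cong (graftW x LB CB c ∷_) (graftWF-++ LB CB xs ys)

  graftRF-++ : ∀ B C xs ys → graftRF x B C (xs ++ ys) ≡ graftRF x B C xs ++ graftRF x B C ys
  graftRF-++ B C []       ys = refl
  graftRF-++ B C (c ∷ xs) ys with soleLeaf x c
  ... | true  = trans (cong (C ++_) (graftRF-++ B C xs ys)) (sym (++-assoc C _ _))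
  ... | false = cong (graftR x B C c ∷_) (graftRF-++ B C xs ys)

  white-++ : ∀ R LB cs CB → red (nd LB CB) ≡ false → red (nd (R ++ LB) (cs ++ CB)) ≡ false
  white-++ (_ ∷ _) LB       cs CB h = refl
  white-++ []      (_ ∷ _)  cs CB h = refl
  white-++ []      []       cs CB h rewrite allWhite-++ cs CB | h = ∧-zeroʳ _

  module White (LB : List ℕ) (CB : List RW) (hB : red (nd LB CB) ≡ false) where
    mutual
      red-graftW : ∀ t → red (graftW x LB CB t) ≡ red t
      red-graftW (nd [] cs) = allWhite-graftWF cs
      red-graftW (nd L@(_ ∷ _) cs) with x ∈ᵇ L
      ... | true  = white-++ (remove x L) LB cs CB hB
      ... | false = refl

      allWhite-graftWF : ∀ cs → allWhite (graftWF x LB CB cs) ≡ allWhite cs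
      allWhite-graftWF []       = refl
      allWhite-graftWF (c ∷ cs) rewrite red-graftW c | allWhite-graftWF cs = refl

  white-∷ʳ-red : ∀ R cs B → red B ≡ true → red (nd R (cs ++ B ∷ [])) ≡ false
  white-∷ʳ-red (_ ∷ _) cs B h = refl
  white-∷ʳ-red []      cs B h rewrite allWhite-++ cs (B ∷ []) | h = ∧-zeroʳ _

  module Red (B : RW) (C : List RW) (hB : red B ≡ true) (hC : allWhite C ≡ true) where
    mutual
      red-graftR : ∀ t → red (graftR x B C t) ≡ red t
      red-graftR (nd [] cs) = allWhite-graftRF cs
      red-graftR (nd L@(_ ∷ _) cs) with x ∈ᵇ L
      ... | true  = white-∷ʳ-red (remove x L) cs B hB
      ... | false = refl

      allWhite-graftRF : ∀ cs → allWhite (graftRF x B C cs) ≡ allWhite cs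
      allWhite-graftRF []       = refl
      allWhite-graftRF (c ∷ cs) with soleLeaf x c in s
      ... | true  rewrite allWhite-++ C (graftRF x B C cs) | hC | allWhite-graftRF cs
                        | soleLeaf⇒white x c s = refl
      ... | false rewrite red-graftR c | allWhite-graftRF cs = refl

red⇒allWhite-children : ∀ B → red B ≡ true → allWhite (children B) ≡ true
red⇒allWhite-children (nd [] cs) h = h

red-η : ∀ B {b} → red B ≡ b → red (nd (labels B) (children B)) ≡ b
red-η (nd _ _) h = h

graftRed : ℕ → RW → RW → RW
graftRed x B t = if soleLeaf x t then B else graftR x B (children B) t

graftWhite : ℕ → RW → RW → RW
graftWhite x B t = graftW x (labels B) (children B) t

graft : ℕ → RW → RW → RW
graft x B t = if red B then graftRed x B t else graftWhite x B t

graftRedF : ℕ → RW → List RW → List RW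
graftRedF x B cs = graftRF x B (children B) cs

graftWhiteF : ℕ → RW → List RW → List RW
graftWhiteF x B cs = graftWF x (labels B) (children B) cs

module GraftRed (x : ℕ) (B : RW) (hB : red B ≡ true) where
  open Graft x

  private
    C = children B

  open Red B C hB (red⇒allWhite-children B hB)

  graftRedF-factors : ∀ A → graftRedF x B (factors A) ≡ factors (graftRed x B A)
  graftRedF-factors (nd [] cs) with allWhite cs in e
  ... | true  rewrite allWhite-graftRF cs | e = refl
  ... | false rewrite allWhite-graftRF cs | e = refl
  graftRedF-factors (nd L@(_ ∷ _) cs) with soleLeaf x (nd L cs)
  ... | true  rewrite hB = ++-identityʳ C
  ... | false rewrite red-graftR (nd L cs) = refl

  graftRed-hang-root : ∀ X E → AvoidsF x E → NonEmpty E → graftRed x B (hang X E) ≡ hang (graftRed x B X) E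
  graftRed-hang-root X [] _ ne = contradiction refl ne
  graftRed-hang-root (nd [] cs) E@(_ ∷ _) nE _ with allWhite cs in e
  ... | true  rewrite graftRF-++ B C E (nd [] cs ∷ []) | graftRF-id B C E nE
                    | allWhite-graftRF cs | e = refl
  ... | false rewrite graftRF-++ B C E cs | graftRF-id B C E nE
                    | allWhite-graftRF cs | e = refl
  graftRed-hang-root (nd (l ∷ []) []) E@(_ ∷ _) nE _ with l ≡ᵇ x
  ... | true  rewrite hB = cong (λ E′ → nd [] (E′ ++ B ∷ [])) (++-identityʳ E)
  ... | false rewrite graftRF-++ B C E [] | graftRF-id B C E nE = refl
  graftRed-hang-root (nd (l ∷ []) cs@(_ ∷ _)) E@(_ ∷ _) nE _ with l ≡ᵇ x
  ... | true  rewrite white-∷ʳ-red [] cs B hB = cong (nd []) (++-assoc E cs (B ∷ []))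
  ... | false rewrite graftRF-++ B C E cs | graftRF-id B C E nE = refl
  graftRed-hang-root (nd L@(_ ∷ _ ∷ _) cs) E@(_ ∷ _) nE _ with x ∈ᵇ L
  ... | true  rewrite white-∷ʳ-red (remove x L) cs B hB = cong (nd _) (++-assoc E cs (B ∷ []))
  ... | false rewrite graftRF-++ B C E cs | graftRF-id B C E nE = refl

  graftRed-hang-below : ∀ X E → Avoids x X → graftRed x B (hang X E) ≡ hang X (graftRedF x B E)
  graftRed-hang-below (nd [] cs) E nX with allWhite cs in e
  ... | true  rewrite graftRF-++ B C E (nd [] cs ∷ [])
                    | graftRF-id B C (nd [] cs ∷ []) (nX , tt) = refl
  ... | false rewrite graftRF-++ B C E cs | graftRF-id B C cs (proj₂ nX) = refl
  graftRed-hang-below (nd L@(_ ∷ _) cs) E (p , q)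
    rewrite soleLeaf-false (E ++ cs) p | ∈ᵇ-false p
          | graftRF-++ B C E cs | graftRF-id B C cs q = refl

  graftRed-joinˡ : ∀ E₁ E₂ → AvoidsF x E₂ → graftRed x B (nd [] (E₁ ++ E₂)) ≡ nd [] (graftRedF x B E₁ ++ E₂)
  graftRed-joinˡ E₁ E₂ n rewrite graftRF-++ B C E₁ E₂ | graftRF-id B C E₂ n = refl

  graftRed-joinʳ : ∀ E₁ E₂ → AvoidsF x E₁ → graftRed x B (nd [] (E₁ ++ E₂)) ≡ nd [] (E₁ ++ graftRedF x B E₂)
  graftRed-joinʳ E₁ E₂ n rewrite graftRF-++ B C E₁ E₂ | graftRF-id B C E₁ n = refl

module GraftWhite (x : ℕ) (B : RW) (hB : red B ≡ false) where
  open Graft x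

  private
    LB = labels B
    CB = children B

    hB′ : red (nd LB CB) ≡ false
    hB′ = red-η B hB

  open White LB CB hB′

  graftWhiteF-factors : ∀ A → graftWhiteF x B (factors A) ≡ factors (graftWhite x B A)
  graftWhiteF-factors (nd [] cs) with allWhite cs in e
  ... | true  rewrite allWhite-graftWF cs | e = refl
  ... | false rewrite allWhite-graftWF cs | e = refl
  graftWhiteF-factors (nd L@(_ ∷ _) cs) rewrite red-graftW (nd L cs) = refl

  graftWhite-hang-root : ∀ X E → AvoidsF x E → graftWhite x B (hang X E) ≡ hang (graftWhite x B X) E
  graftWhite-hang-root (nd [] cs) E nE with allWhite cs in e
  ... | true  rewrite graftWF-++ LB CB E (nd [] cs ∷ []) | graftWF-id LB CB E nE
                    | allWhite-graftWF cs | e = refl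
  ... | false rewrite graftWF-++ LB CB E cs | graftWF-id LB CB E nE
                    | allWhite-graftWF cs | e = refl
  graftWhite-hang-root (nd L@(_ ∷ _) cs) E nE with x ∈ᵇ L
  ... | true  rewrite white-++ (remove x L) (labels B) cs (children B) hB′ = cong (nd _) (++-assoc E cs (children B))
  ... | false rewrite graftWF-++ LB CB E cs | graftWF-id LB CB E nE = refl

  graftWhite-hang-below : ∀ X E → Avoids x X → graftWhite x B (hang X E) ≡ hang X (graftWhiteF x B E)
  graftWhite-hang-below (nd [] cs) E nX with allWhite cs in e
  ... | true  rewrite graftWF-++ LB CB E (nd [] cs ∷ [])
                    | graftWF-id LB CB (nd [] cs ∷ []) (nX , tt) = refl
  ... | false rewrite graftWF-++ LB CB E cs | graftWF-id LB CB cs (proj₂ nX) = refl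
  graftWhite-hang-below (nd (_ ∷ _) cs) E (p , q)
    rewrite ∈ᵇ-false p | graftWF-++ LB CB E cs | graftWF-id LB CB cs q = refl

  graftWhite-joinˡ : ∀ E₁ E₂ → AvoidsF x E₂ → graftWhite x B (nd [] (E₁ ++ E₂)) ≡ nd [] (graftWhiteF x B E₁ ++ E₂)
  graftWhite-joinˡ E₁ E₂ n rewrite graftWF-++ LB CB E₁ E₂ | graftWF-id LB CB E₂ n = refl

  graftWhite-joinʳ : ∀ E₁ E₂ → AvoidsF x E₁ → graftWhite x B (nd [] (E₁ ++ E₂)) ≡ nd [] (E₁ ++ graftWhiteF x B E₂)
  graftWhite-joinʳ E₁ E₂ n rewrite graftWF-++ LB CB E₁ E₂ | graftWF-id LB CB E₁ n = refl

graftF : ℕ → RW → List RW → List RW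
graftF x B cs = if red B then graftRedF x B cs else graftWhiteF x B cs

graftF-factors : ∀ x B A → graftF x B (factors A) ≡ factors (graft x B A)
graftF-factors x B A with red B in hB
... | true  = GraftRed.graftRedF-factors x B hB A
... | false = GraftWhite.graftWhiteF-factors x B hB A

graft-hang-root : ∀ x B X E → AvoidsF x E → NonEmpty E → graft x B (hang X E) ≡ hang (graft x B X) E
graft-hang-root x B X E nE ne with red B in hB
... | true  = GraftRed.graftRed-hang-root x B hB X E nE ne
... | false = GraftWhite.graftWhite-hang-root x B hB X E nE

graft-hang-below : ∀ x B X E → Avoids x X → graft x B (hang X E) ≡ hang X (graftF x B E)
graft-hang-below x B X E nX with red B in hB
... | true  = GraftRed.graftRed-hang-below x B hB X E nX
... | false = GraftWhite.graftWhite-hang-below x B hB X E nX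

graft-joinˡ : ∀ x B E₁ E₂ → AvoidsF x E₂ → graft x B (nd [] (E₁ ++ E₂)) ≡ nd [] (graftF x B E₁ ++ E₂)
graft-joinˡ x B E₁ E₂ n with red B in hB
... | true  = GraftRed.graftRed-joinˡ x B hB E₁ E₂ n
... | false = GraftWhite.graftWhite-joinˡ x B hB E₁ E₂ n

graft-joinʳ : ∀ x B E₁ E₂ → AvoidsF x E₁ → graft x B (nd [] (E₁ ++ E₂)) ≡ nd [] (E₁ ++ graftF x B E₂)
graft-joinʳ x B E₁ E₂ n with red B in hB
... | true  = GraftRed.graftRed-joinʳ x B hB E₁ E₂ n
... | false = GraftWhite.graftWhite-joinʳ x B hB E₁ E₂ n

graft-evOpˡ : ∀ o x B A Y → Avoids x Y → NonEmpty (factors Y) →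
              graft x B (evOp o A Y) ≡ evOp o (graft x B A) Y
graft-evOpˡ prec x B A Y nY ne = graft-hang-root x B A (factors Y) (AllLabelsF-factors Y nY) ne
graft-evOpˡ succ x B A Y nY ne = trans (graft-hang-below x B Y (factors A) nY) (cong (hang Y) (graftF-factors x B A))
graft-evOpˡ odot x B A Y nY ne = trans (graft-joinˡ x B (factors A) (factors Y) (AllLabelsF-factors Y nY))
                                       (cong (λ E → nd [] (E ++ factors Y)) (graftF-factors x B A))
graft-evOpˡ circ x B A Y nY ne = graft-evOpˡ odot x B A Y nY ne

graft-evOpʳ : ∀ o x B A Y → Avoids x A → NonEmpty (factors A) →
              graft x B (evOp o A Y) ≡ evOp o A (graft x B Y)
graft-evOpʳ prec x B A Y nA ne = trans (graft-hang-below x B A (factors Y) nA) (cong (hang A) (graftF-factors x B Y))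
graft-evOpʳ succ x B A Y nA ne = graft-hang-root x B Y (factors A) (AllLabelsF-factors A nA) ne
graft-evOpʳ odot x B A Y nA ne = trans (graft-joinʳ x B (factors A) (factors Y) (AllLabelsF-factors A nA))
                                       (cong (λ E → nd [] (factors A ++ E)) (graftF-factors x B Y))
graft-evOpʳ circ x B A Y nA ne = graft-evOpʳ odot x B A Y nA ne

module _ (g : ℕ → ℕ) (g-inj : ∀ m n → (g m ≡ᵇ g n) ≡ (m ≡ᵇ n)) where

  ∈ᵇ-map : ∀ x L → (g x ∈ᵇ map g L) ≡ (x ∈ᵇ L)
  ∈ᵇ-map x []      = refl
  ∈ᵇ-map x (y ∷ L) rewrite g-inj y x | ∈ᵇ-map x L = refl

  remove-map : ∀ x L → map g (remove x L) ≡ remove (g x) (map g L)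
  remove-map x []      = refl
  remove-map x (y ∷ L) rewrite g-inj y x with y ≡ᵇ x
  ... | true  = remove-map x L
  ... | false = cong (g y ∷_) (remove-map x L)

  soleLeaf-relabel : ∀ x t → soleLeaf (g x) (relabel g t) ≡ soleLeaf x t
  soleLeaf-relabel x (nd []          cs)      = refl
  soleLeaf-relabel x (nd (y ∷ [])    [])      = g-inj y x
  soleLeaf-relabel x (nd (y ∷ [])    (_ ∷ _)) = refl
  soleLeaf-relabel x (nd (_ ∷ _ ∷ _) cs)      = refl

  mutual
    relabel-graftW : ∀ x LB CB t →
      relabel g (graftW x LB CB t) ≡ graftW (g x) (map g LB) (relabelF g CB) (relabel g t)
    relabel-graftW x LB CB (nd L cs) rewrite ∈ᵇ-map x L with x ∈ᵇ L
    ... | true  rewrite map-++ g (remove x L) LB | remove-map x L | relabelF-++ g cs CB = refl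
    ... | false = cong (nd (map g L)) (relabel-graftWF x LB CB cs)

    relabel-graftWF : ∀ x LB CB cs →
      relabelF g (graftWF x LB CB cs) ≡ graftWF (g x) (map g LB) (relabelF g CB) (relabelF g cs)
    relabel-graftWF x LB CB []       = refl
    relabel-graftWF x LB CB (c ∷ cs) = cong₂ _∷_ (relabel-graftW x LB CB c) (relabel-graftWF x LB CB cs)

  mutual
    relabel-graftR : ∀ x B C t →
      relabel g (graftR x B C t) ≡ graftR (g x) (relabel g B) (relabelF g C) (relabel g t)
    relabel-graftR x B C (nd L cs) rewrite ∈ᵇ-map x L with x ∈ᵇ L
    ... | true  rewrite remove-map x L | relabelF-++ g cs (B ∷ []) = refl
    ... | false = cong (nd (map g L)) (relabel-graftRF x B C cs)

    relabel-graftRF : ∀ x B C cs →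
      relabelF g (graftRF x B C cs) ≡ graftRF (g x) (relabel g B) (relabelF g C) (relabelF g cs)
    relabel-graftRF x B C []       = refl
    relabel-graftRF x B C (c ∷ cs) rewrite soleLeaf-relabel x c with soleLeaf x c
    ... | true  rewrite relabelF-++ g C (graftRF x B C cs) = cong (relabelF g C ++_) (relabel-graftRF x B C cs)
    ... | false = cong₂ _∷_ (relabel-graftR x B C c) (relabel-graftRF x B C cs)

  relabel-graft : ∀ x B t → relabel g (graft x B t) ≡ graft (g x) (relabel g B) (relabel g t)
  relabel-graft x B t rewrite red-relabel g B | soleLeaf-relabel x t | labels-relabel g B
                            | children-relabel g B with red B
  ... | true with soleLeaf x t
  ...   | true  = refl
  ...   | false = relabel-graftR x B (children B) t
  relabel-graft x B t | false = relabel-graftW x (labels B) (children B) t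

+-≡ᵇ-cancelʳ : ∀ w m n → (m + w ≡ᵇ n + w) ≡ (m ≡ᵇ n)
+-≡ᵇ-cancelʳ w m n with m ≟ n
... | yes refl = trans (Equivalence.to T-≡ (≡⇒≡ᵇ (n + w) (n + w) refl)) (sym (Equivalence.to T-≡ (≡⇒≡ᵇ n n refl)))
... | no m≢n   = trans (≢⇒≡ᵇ-false (λ e → m≢n (+-cancelʳ-≡ w m n e))) (sym (≢⇒≡ᵇ-false m≢n))

-- Evaluation is compositional

openGap : ℕ → ℕ → ℕ → ℕ
openGap x k y = if x <ᵇ y then y + k ∸ 1 else y

compRW-graft : ∀ T₁ x T₂ → compRW T₁ x T₂ ≡ graft x (shift (x ∸ 1) T₂) (relabel (openGap x (weight T₂)) T₁)
compRW-graft T₁ x T₂ = refl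

openGap-above : ∀ {x y} k → x < y → openGap x k y ≡ y + k ∸ 1
openGap-above {x} {y} k x<y rewrite Equivalence.to T-≡ (<⇒<ᵇ x<y) = refl

openGap-below : ∀ {x y} k → y ≤ x → openGap x k y ≡ y
openGap-below {x} {y} k y≤x with x <ᵇ y in e
... | true  = contradiction (<ᵇ⇒< x y (Equivalence.from T-≡ e)) (≤⇒≯ y≤x)
... | false = refl

openGap-shift : ∀ x k w y → 1 ≤ k → openGap (x + w) k (y + w) ≡ openGap x k y + w
openGap-shift x k w y 1≤k with x <? y
... | yes x<y rewrite openGap-above k x<y | openGap-above {x + w} k (+-monoˡ-< w x<y)
                    | +-∸-assoc (y + w) 1≤k | +-∸-assoc y 1≤k = +-rightComm y w (k ∸ 1)
... | no x≮y  rewrite openGap-below k (≮⇒≥ x≮y) | openGap-below {x + w} k (+-monoˡ-≤ w (≮⇒≥ x≮y)) = refl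

avoids-below : ∀ {w x} t → AllLabels (_≤ w) t → w < x → Avoids x t
avoids-below {w} t h w<x = AllLabels-map (λ y≤w y≡x → <⇒≢ (≤-<-trans y≤w w<x) y≡x) t h

avoids-shift : ∀ {x w} t → AllLabels (1 ≤_) t → x ≤ w → Avoids x (shift w t)
avoids-shift {x} {w} t h x≤w =
  AllLabels-relabel (λ y → y + w) t (AllLabels-map (λ {y} 1≤y e → <⇒≢ (≤-<-trans x≤w (m<n+m w 1≤y)) (sym e)) t h)

relabel-openGap-shift : ∀ {x k w} t → AllLabels (1 ≤_) t → x ≤ w → 1 ≤ k →
                        relabel (openGap x k) (shift w t) ≡ shift (w + k ∸ 1) t
relabel-openGap-shift {x} {k} {w} t h x≤w 1≤k = trans (relabel-∘ (openGap x k) (λ y → y + w) t)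
  (relabel-cong t (AllLabels-map (λ {y} 1≤y →
     trans (openGap-above k (≤-<-trans x≤w (m<n+m w 1≤y)))
           (trans (+-∸-assoc (y + w) 1≤k) (trans (+-assoc y w (k ∸ 1)) (cong (y +_) (sym (+-∸-assoc w 1≤k))))))
     t h))

shift-relabel-openGap : ∀ {x k} w t → 1 ≤ k →
                        shift w (relabel (openGap x k) t) ≡ relabel (openGap (x + w) k) (shift w t)
shift-relabel-openGap {x} {k} w t 1≤k = trans (relabel-∘ (λ y → y + w) (openGap x k) t)
  (sym (trans (relabel-∘ (openGap (x + w) k) (λ y → y + w) t)
              (relabel-cong t (AllLabels-universal (λ y → openGap-shift x k w y 1≤k) t))))

shift-shift-pred : ∀ {j} w t → 1 ≤ j → shift w (shift (j ∸ 1) t) ≡ shift (j + w ∸ 1) t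
shift-shift-pred {suc j} w t _ = trans (shift-shift w j t) (cong (λ n → shift n t) (+-comm w j))

weight-toTree-positive : ∀ b → 1 ≤ weight (toTree b)
weight-toTree-positive b = subst (1 ≤_) (sym (weight-toTree b)) (ar-positive b)

toTree-∘⟨⟩-nodeˡ : ∀ o a₁ a₂ b i → 1 ≤ i → i ≤ ar a₁ →
                   toTree (a₁ ∘⟨ i ⟩ b) ≡ compRW (toTree a₁) i (toTree b) →
                   toTree (node o a₁ a₂ ∘⟨ i ⟩ b) ≡ compRW (toTree (node o a₁ a₂)) i (toTree b)
toTree-∘⟨⟩-nodeˡ o a₁ a₂ b i 1≤i i≤a₁ ih = begin
    toTree (node o a₁ a₂ ∘⟨ i ⟩ b)
  ≡⟨ cong toTree (∘⟨⟩-nodeˡ o a₁ a₂ b i≤a₁) ⟩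
    evOp o (toTree (a₁ ∘⟨ i ⟩ b)) (shift (ar (a₁ ∘⟨ i ⟩ b)) (toTree a₂))
  ≡⟨ cong₂ (λ A w → evOp o A (shift w (toTree a₂))) ih ar-eq ⟩
    evOp o (graft i B (relabel f (toTree a₁))) Y
  ≡⟨ graft-evOpˡ o i B _ Y (avoids-shift (toTree a₂) (positive a₂) (≤-trans i≤a₁ a₁≤))
                         (factors-relabel-nonEmpty _ (toTree a₂) (factors-toTree-nonEmpty a₂)) ⟨
    graft i B (evOp o (relabel f (toTree a₁)) Y)
  ≡⟨ cong (λ Y → graft i B (evOp o (relabel f (toTree a₁)) Y))
          (relabel-openGap-shift (toTree a₂) (positive a₂) i≤a₁ (weight-toTree-positive b)) ⟨
    graft i B (evOp o (relabel f (toTree a₁)) (relabel f (shift (ar a₁) (toTree a₂))))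
  ≡⟨ cong (graft i B) (evOp-relabel o f (toTree a₁) (shift (ar a₁) (toTree a₂))) ⟨
    graft i B (relabel f (toTree (node o a₁ a₂)))
  ≡⟨ compRW-graft (toTree (node o a₁ a₂)) i (toTree b) ⟨
    compRW (toTree (node o a₁ a₂)) i (toTree b)
  ∎
  where
  open ≡-Reasoning
  k = weight (toTree b)
  B = shift (i ∸ 1) (toTree b)
  f = openGap i k
  Y = shift (ar a₁ + k ∸ 1) (toTree a₂)
  ar-eq : ar (a₁ ∘⟨ i ⟩ b) ≡ ar a₁ + k ∸ 1
  ar-eq = trans (ar-∘⟨⟩ a₁ b i 1≤i i≤a₁) (cong (λ n → ar a₁ + n ∸ 1) (sym (weight-toTree b)))
  a₁≤ : ar a₁ ≤ ar a₁ + k ∸ 1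
  a₁≤ = subst (ar a₁ ≤_) (sym (+-∸-assoc (ar a₁) (weight-toTree-positive b))) (m≤m+n (ar a₁) (k ∸ 1))

toTree-∘⟨⟩-nodeʳ : ∀ o a₁ a₂ b j → 1 ≤ j →
                   toTree (a₂ ∘⟨ j ⟩ b) ≡ compRW (toTree a₂) j (toTree b) →
                   toTree (node o a₁ a₂ ∘⟨ j + ar a₁ ⟩ b) ≡ compRW (toTree (node o a₁ a₂)) (j + ar a₁) (toTree b)
toTree-∘⟨⟩-nodeʳ o a₁ a₂ b j 1≤j ih = begin
    toTree (node o a₁ a₂ ∘⟨ x ⟩ b)
  ≡⟨ cong toTree (∘⟨⟩-nodeʳ o a₁ a₂ b (m<n+m (ar a₁) 1≤j)) ⟩
    evOp o (toTree a₁) (shift (ar a₁) (toTree (a₂ ∘⟨ x ∸ ar a₁ ⟩ b)))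
  ≡⟨ cong (λ T → evOp o (toTree a₁) (shift (ar a₁) (toTree (a₂ ∘⟨ T ⟩ b)))) (m+n∸n≡m j (ar a₁)) ⟩
    evOp o (toTree a₁) (shift (ar a₁) (toTree (a₂ ∘⟨ j ⟩ b)))
  ≡⟨ cong (λ T → evOp o (toTree a₁) (shift (ar a₁) T)) ih ⟩
    evOp o (toTree a₁) (shift (ar a₁) (graft j Bⱼ Y₂))
  ≡⟨ cong (evOp o (toTree a₁)) (relabel-graft (λ y → y + ar a₁) (+-≡ᵇ-cancelʳ (ar a₁)) j Bⱼ Y₂) ⟩
    evOp o (toTree a₁) (graft x (shift (ar a₁) Bⱼ) (shift (ar a₁) Y₂))
  ≡⟨ graft-evOpʳ o x (shift (ar a₁) Bⱼ) (toTree a₁) (shift (ar a₁) Y₂)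
                 (avoids-below (toTree a₁) (bounded a₁) (m<n+m (ar a₁) 1≤j)) (factors-toTree-nonEmpty a₁) ⟨
    graft x (shift (ar a₁) Bⱼ) (evOp o (toTree a₁) (shift (ar a₁) Y₂))
  ≡⟨ cong₂ (graft x) (shift-shift-pred (ar a₁) (toTree b) 1≤j)
                     (cong₂ (evOp o) (sym (relabel-identity (toTree a₁) fixes-a₁))
                                     (shift-relabel-openGap (ar a₁) (toTree a₂) (weight-toTree-positive b))) ⟩
    graft x (shift (x ∸ 1) (toTree b)) (evOp o (relabel f (toTree a₁)) (relabel f (shift (ar a₁) (toTree a₂))))
  ≡⟨ cong (graft x (shift (x ∸ 1) (toTree b))) (evOp-relabel o f (toTree a₁) (shift (ar a₁) (toTree a₂))) ⟨
    graft x (shift (x ∸ 1) (toTree b)) (relabel f (toTree (node o a₁ a₂)))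
  ≡⟨ compRW-graft (toTree (node o a₁ a₂)) x (toTree b) ⟨
    compRW (toTree (node o a₁ a₂)) x (toTree b)
  ∎
  where
  open ≡-Reasoning
  k  = weight (toTree b)
  x  = j + ar a₁
  f  = openGap x k
  Bⱼ = shift (j ∸ 1) (toTree b)
  Y₂ = relabel (openGap j k) (toTree a₂)
  fixes-a₁ : AllLabels (λ y → f y ≡ y) (toTree a₁)
  fixes-a₁ = AllLabels-map (λ y≤a₁ → openGap-below k (≤-trans y≤a₁ (m≤n+m (ar a₁) j))) (toTree a₁) (bounded a₁)

toTree-∘⟨⟩ : ∀ a b i → 1 ≤ i → i ≤ ar a → toTree (a ∘⟨ i ⟩ b) ≡ compRW (toTree a) i (toTree b)
toTree-∘⟨⟩ leaf b (suc (suc _)) _ (s≤s ())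
toTree-∘⟨⟩ leaf b (suc zero) _ _ rewrite shift-zero (toTree b) with red (toTree b)
... | true  = refl
... | false = sym (nd-η (toTree b))
toTree-∘⟨⟩ (node o a₁ a₂) b i 1≤i i≤ with i ≤? ar a₁
... | yes i≤a₁ = toTree-∘⟨⟩-nodeˡ o a₁ a₂ b i 1≤i i≤a₁ (toTree-∘⟨⟩ a₁ b i 1≤i i≤a₁)
... | no  i≰a₁ = subst (λ x → toTree (node o a₁ a₂ ∘⟨ x ⟩ b) ≡ compRW (toTree (node o a₁ a₂)) x (toTree b))
                       (m∸n+n≡m (<⇒≤ a₁<i))
                       (toTree-∘⟨⟩-nodeʳ o a₁ a₂ b (i ∸ ar a₁) (m<n⇒0<n∸m a₁<i)
                         (toTree-∘⟨⟩ a₂ b (i ∸ ar a₁) (m<n⇒0<n∸m a₁<i) (m≤n+o⇒m∸n≤o i (ar a₁) i≤)))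
  where a₁<i = ≰⇒> i≰a₁

-- Equality of trees; evaluation respects the ∘-free relations

mutual
  ≈T-refl : ∀ t → t ≈T t
  ≈T-refl (nd L cs) = nd≈ ↭-refl (≈F-refl cs)

  ≈F-refl : ∀ cs → cs ≈F cs
  ≈F-refl []       = []≈
  ≈F-refl (c ∷ cs) = ∷≈ (≈T-refl c) (≈F-refl cs)

mutual
  ≈T-sym : ∀ {s t} → s ≈T t → t ≈T s
  ≈T-sym (nd≈ p q) = nd≈ (↭-sym p) (≈F-sym q)

  ≈F-sym : ∀ {s t} → s ≈F t → t ≈F s
  ≈F-sym []≈          = []≈
  ≈F-sym (∷≈ p q)     = ∷≈ (≈T-sym p) (≈F-sym q)
  ≈F-sym swap≈        = swap≈
  ≈F-sym (trans≈ p q) = trans≈ (≈F-sym q) (≈F-sym p)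

≈T-trans : ∀ {s t u} → s ≈T t → t ≈T u → s ≈T u
≈T-trans (nd≈ p q) (nd≈ p′ q′) = nd≈ (↭-trans p p′) (trans≈ q q′)

≡⇒≈T : ∀ {s t} → s ≡ t → s ≈T t
≡⇒≈T {s} refl = ≈T-refl s

↭⇒≈F : ∀ {xs ys} → xs ↭ ys → xs ≈F ys
↭⇒≈F {xs} ↭.refl   = ≈F-refl xs
↭⇒≈F (↭.prep x p)   = ∷≈ (≈T-refl x) (↭⇒≈F p)
↭⇒≈F (↭.swap x y p) = trans≈ swap≈ (∷≈ (≈T-refl y) (∷≈ (≈T-refl x) (↭⇒≈F p)))
↭⇒≈F (↭.trans p q)  = trans≈ (↭⇒≈F p) (↭⇒≈F q)

≈F-++ʳ : ∀ {xs xs′} ys → xs ≈F xs′ → (xs ++ ys) ≈F (xs′ ++ ys)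
≈F-++ʳ ys []≈          = ≈F-refl ys
≈F-++ʳ ys (∷≈ p q)     = ∷≈ p (≈F-++ʳ ys q)
≈F-++ʳ ys swap≈        = swap≈
≈F-++ʳ ys (trans≈ p q) = trans≈ (≈F-++ʳ ys p) (≈F-++ʳ ys q)

≈F-++ˡ : ∀ xs {ys ys′} → ys ≈F ys′ → (xs ++ ys) ≈F (xs ++ ys′)
≈F-++ˡ []       p = p
≈F-++ˡ (x ∷ xs) p = ∷≈ (≈T-refl x) (≈F-++ˡ xs p)

≈F-++ : ∀ {xs xs′ ys ys′} → xs ≈F xs′ → ys ≈F ys′ → (xs ++ ys) ≈F (xs′ ++ ys′)
≈F-++ {xs′ = xs′} {ys = ys} p q = trans≈ (≈F-++ʳ ys p) (≈F-++ˡ xs′ q)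

∧-swap : ∀ a b c → a ∧ (b ∧ c) ≡ b ∧ (a ∧ c)
∧-swap true  b     c = refl
∧-swap false true  c = refl
∧-swap false false c = refl

mutual
  red-≈ : ∀ {s t} → s ≈T t → red s ≡ red t
  red-≈ (nd≈ {[]}    {[]}    p q) = allWhite-≈ q
  red-≈ (nd≈ {[]}    {_ ∷ _} p q) with () ← ↭-length p
  red-≈ (nd≈ {_ ∷ _} {[]}    p q) with () ← ↭-length p
  red-≈ (nd≈ {_ ∷ _} {_ ∷ _} p q) = refl

  allWhite-≈ : ∀ {s t} → s ≈F t → allWhite s ≡ allWhite t
  allWhite-≈ []≈                    = refl
  allWhite-≈ (∷≈ p q)               = cong₂ (λ r w → not r ∧ w) (red-≈ p) (allWhite-≈ q)
  allWhite-≈ (swap≈ {t} {t′} {ts})  = ∧-swap (not (red t)) (not (red t′)) (allWhite ts)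
  allWhite-≈ (trans≈ p q)           = trans (allWhite-≈ p) (allWhite-≈ q)

factors-≈ : ∀ {s t} → s ≈T t → factors s ≈F factors t
factors-≈ {s} {t} p with red s | red t | red-≈ p
factors-≈ (nd≈ p q) | true  | .true  | refl = q
factors-≈ (nd≈ p q) | false | .false | refl = ∷≈ (nd≈ p q) []≈

hang-≈ : ∀ {X X′ E E′} → X ≈T X′ → E ≈F E′ → hang X E ≈T hang X′ E′
hang-≈ {X} {X′} p e with red X | red X′ | red-≈ p
hang-≈ (nd≈ p q) e | true  | .true  | refl = nd≈ ↭-refl (≈F-++ e (∷≈ (nd≈ p q) []≈))
hang-≈ (nd≈ p q) e | false | .false | refl = nd≈ p (≈F-++ e q)

evOp-≈ : ∀ o {A A′ Y Y′} → A ≈T A′ → Y ≈T Y′ → evOp o A Y ≈T evOp o A′ Y′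
evOp-≈ prec a y = hang-≈ a (factors-≈ y)
evOp-≈ succ a y = hang-≈ y (factors-≈ a)
evOp-≈ odot a y = nd≈ ↭-refl (≈F-++ (factors-≈ a) (factors-≈ y))
evOp-≈ circ a y = nd≈ ↭-refl (≈F-++ (factors-≈ a) (factors-≈ y))

mutual
  relabel-≈ : ∀ f {s t} → s ≈T t → relabel f s ≈T relabel f t
  relabel-≈ f (nd≈ p q) = nd≈ (Perm.map⁺ f p) (relabelF-≈ f q)

  relabelF-≈ : ∀ f {s t} → s ≈F t → relabelF f s ≈F relabelF f t
  relabelF-≈ f []≈          = []≈
  relabelF-≈ f (∷≈ p q)     = ∷≈ (relabel-≈ f p) (relabelF-≈ f q)
  relabelF-≈ f swap≈        = swap≈
  relabelF-≈ f (trans≈ p q) = trans≈ (relabelF-≈ f p) (relabelF-≈ f q)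

allWhite-factors : ∀ t → allWhite (factors t) ≡ true
allWhite-factors (nd [] cs) with allWhite cs in e
... | true  = e
... | false rewrite e = refl
allWhite-factors (nd (_ ∷ _) cs) = refl

white-hang : ∀ Y E → red (hang Y E) ≡ false
white-hang (nd [] cs) E with allWhite cs in e
... | true  rewrite allWhite-++ E (nd [] cs ∷ []) | e = ∧-zeroʳ _
... | false rewrite allWhite-++ E cs | e = ∧-zeroʳ _
white-hang (nd (_ ∷ _) cs) E = refl

factors-join : ∀ X Y → factors (join X Y) ≡ factors X ++ factors Y
factors-join X Y rewrite allWhite-++ (factors X) (factors Y) | allWhite-factors X | allWhite-factors Y = refl

hang-hang : ∀ X E₁ E₂ → hang (hang X E₁) E₂ ≈T hang X (E₂ ++ E₁)
hang-hang X E₁ E₂ rewrite white-hang X E₁ with red X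
... | true  = nd≈ ↭-refl (↭⇒≈F (↭-reflexive (sym (++-assoc E₂ E₁ _))))
... | false = nd≈ ↭-refl (↭⇒≈F (↭-reflexive (sym (++-assoc E₂ E₁ _))))

hang-++-comm : ∀ X E₁ E₂ → hang X (E₁ ++ E₂) ≈T hang X (E₂ ++ E₁)
hang-++-comm X E₁ E₂ = hang-≈ (≈T-refl X) (↭⇒≈F (++-comm E₁ E₂))

-- Rules r1, r6, r7, r8 are exactly those free of ∘.
evOp-rule : ∀ {o₁ o₂ o₃ o₄} → Rule o₁ o₂ o₃ o₄ → circFree (node o₁ (node o₂ leaf leaf) leaf) ≡ true →
            ∀ X Y Z → evOp o₁ (evOp o₂ X Y) Z ≈T evOp o₃ X (evOp o₄ Y Z)
evOp-rule rule₁ _ X Y Z =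
  ≈T-trans (hang-hang Y (factors X) (factors Z))
    (≈T-trans (hang-++-comm Y (factors Z) (factors X)) (≈T-sym (hang-hang Y (factors Z) (factors X))))
evOp-rule rule₆ _ X Y Z rewrite factors-join X Y | factors-join Y Z =
  nd≈ ↭-refl (↭⇒≈F (↭-reflexive (++-assoc (factors X) (factors Y) (factors Z))))
evOp-rule rule₇ _ X Y Z rewrite factors-join Y Z =
  ≈T-trans (hang-hang X (factors Y) (factors Z)) (hang-++-comm X (factors Z) (factors Y))
evOp-rule rule₈ _ X Y Z rewrite factors-join X Y = ≈T-sym (hang-hang Z (factors Y) (factors X))

toTree-rule : ∀ {o₁ o₂ o₃ o₄} → Rule o₁ o₂ o₃ o₄ → ∀ x y z →
              circFree (node o₁ (node o₂ x y) z) ≡ true →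
              toTree (node o₁ (node o₂ x y) z) ≈T toTree (node o₃ x (node o₄ y z))
toTree-rule {o₁} {o₂} {o₃} {o₄} r x y z h =
  ≈T-trans (evOp-rule r (lhs-circFree r h) (toTree x) (shift (ar x) (toTree y)) (shift (ar x + ar y) (toTree z)))
    (≡⇒≈T (cong (evOp o₃ (toTree x)) (sym
      (trans (evOp-relabel o₄ (λ v → v + ar x) (toTree y) (shift (ar y) (toTree z)))
             (cong (evOp o₄ (shift (ar x) (toTree y))) (shift-shift (ar x) (ar y) (toTree z)))))))
  where
  lhs-circFree : ∀ {o₁ o₂ o₃ o₄} → Rule o₁ o₂ o₃ o₄ → circFree (node o₁ (node o₂ x y) z) ≡ true →
                 circFree (node o₁ (node o₂ leaf leaf) leaf) ≡ true
  lhs-circFree rule₁ _ = refl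
  lhs-circFree rule₆ _ = refl
  lhs-circFree rule₇ _ = refl
  lhs-circFree rule₈ _ = refl

toTree-resp-≋ : ∀ {a b} → a ≋ b → circFree a ≡ true → toTree a ≈T toTree b
toTree-resp-≋ (rule r x y z) h = toTree-rule r x y z h
toTree-resp-≋ {a} ≋-refl h = ≈T-refl (toTree a)
toTree-resp-≋ (≋-sym p) h = ≈T-sym (toTree-resp-≋ p (trans (circFree-≋ p) h))
toTree-resp-≋ (≋-trans p q) h = ≈T-trans (toTree-resp-≋ p h) (toTree-resp-≋ q (trans (sym (circFree-≋ p)) h))
toTree-resp-≋ (congˡ {o} {a} {a′} {b} p) h =
  evOp-≈ o (toTree-resp-≋ p (circFreeˡ o a b h)) (≡⇒≈T (cong (λ n → shift n (toTree b)) (ar-≋ p)))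
toTree-resp-≋ (congʳ {o} {a} {b} {b′} p) h =
  evOp-≈ o (≈T-refl (toTree a)) (relabel-≈ _ (toTree-resp-≋ p (circFreeʳ o a b h)))

-- Sorting items

record Item : Set where
  constructor item
  field
    key   : ℕ
    pivot : Bool
    term  : Tm
open Item public

opCode : Op4 → ℕ
opCode prec = 0
opCode succ = 1
opCode circ = 2
opCode odot = 3

opCode-injective : ∀ {o o′} → opCode o ≡ opCode o′ → o ≡ o′
opCode-injective {prec} {prec} _ = refl
opCode-injective {succ} {succ} _ = refl
opCode-injective {circ} {circ} _ = refl
opCode-injective {odot} {odot} _ = refl

encodeTm : Tm → List ℕ
encodeTm leaf         = 0 ∷ []
encodeTm (node o a b) = suc (opCode o) ∷ (encodeTm a ++ encodeTm b)

encodeTm-injective : ∀ a a′ r r′ → encodeTm a ++ r ≡ encodeTm a′ ++ r′ → a ≡ a′ × r ≡ r′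
encodeTm-injective leaf         leaf           r r′ e = refl , proj₂ (∷-injective e)
encodeTm-injective (node o a b) (node o′ a′ b′) r r′ e with ∷-injective e
... | head , tail with opCode-injective (suc-injective head)
...   | refl with encodeTm-injective a a′ (encodeTm b ++ r) (encodeTm b′ ++ r′)
                  (trans (sym (++-assoc (encodeTm a) (encodeTm b) r)) (trans tail (++-assoc (encodeTm a′) (encodeTm b′) r′)))
...     | refl , rest with encodeTm-injective b b′ r r′ rest
...       | refl , refl = refl , refl

boolCode : Bool → ℕ
boolCode false = 0
boolCode true  = 1

boolCode-injective : ∀ {b b′} → boolCode b ≡ boolCode b′ → b ≡ b′
boolCode-injective {false} {false} _ = refl
boolCode-injective {true}  {true}  _ = refl

encode : Item → List ℕ
encode (item k p t) = k ∷ boolCode p ∷ encodeTm t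

encode-injective : ∀ {x y} → encode x ≡ encode y → x ≡ y
encode-injective {item k p t} {item k′ p′ t′} e with ∷-injective e
... | refl , e′ with ∷-injective e′
...   | ep , et with encodeTm-injective t t′ [] [] (trans (++-identityʳ _) (trans et (sym (++-identityʳ _))))
...     | refl , _ rewrite boolCode-injective ep = refl

module LexOrder = DecTotalOrder (Lex.≤-decTotalOrder ≤-decTotalOrder)

infix 4 _≤ᴵ_
_≤ᴵ_ : Item → Item → Set
x ≤ᴵ y = encode x LexOrder.≤ encode y

-- Items are compared by key first; the rest of the order only serves to make it total.
itemOrder : DecTotalOrder 0ℓ 0ℓ 0ℓ
itemOrder = record
  { Carrier         = Item
  ; _≈_             = _≡_
  ; _≤_             = _≤ᴵ_
  ; isDecTotalOrder = record
    { isTotalOrder = record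
      { isPartialOrder = record
        { isPreorder = record
          { isEquivalence = isEquivalence
          ; reflexive     = λ { refl → LexOrder.refl }
          ; trans         = LexOrder.trans
          }
        ; antisym = λ p q → encode-injective (Pointwise-≡⇒≡ (LexOrder.antisym p q))
        }
      ; total = λ x y → LexOrder.total (encode x) (encode y)
      }
    ; _≟_  = λ x y → map′ encode-injective (cong encode) (≡-dec _≟_ (encode x) (encode y))
    ; _≤?_ = λ x y → encode x LexOrder.≤? encode y
    }
  }

key<⇒≤ᴵ : ∀ {x y} → key x < key y → x ≤ᴵ y
key<⇒≤ᴵ k<k′ = LexCore.this (<⇒≤ k<k′ , <⇒≢ k<k′)

open DecTotalOrder itemOrder using (totalOrder)
open import Data.List.Relation.Unary.Sorted.TotalOrder totalOrder using (Sorted)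
open import Data.List.Sort.InsertionSort.Base itemOrder using (sort)
open import Data.List.Sort.InsertionSort.Properties itemOrder using (sort-↭; sort-↗)

sorted-unique : ∀ {xs ys} → Sorted xs → Sorted ys → xs ↭ ys → xs ≡ ys
sorted-unique xs↗ ys↗ xs↭ys = Pointwise-≡⇒≡ (↗↭↗⇒≋ totalOrder xs↗ ys↗ (↭⇒↭ₛ xs↭ys))

sort-resp-↭ : ∀ {xs ys} → xs ↭ ys → sort xs ≡ sort ys
sort-resp-↭ {xs} {ys} p = sorted-unique (sort-↗ xs) (sort-↗ ys)
  (↭-trans (sort-↭ xs) (↭-trans p (↭-sym (sort-↭ ys))))

All-sort : ∀ {P : Item → Set} {xs} → All P xs → All P (sort xs)
All-sort {xs = xs} = All-resp-↭ (↭-sym (sort-↭ xs))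

Any-sort : ∀ {P : Item → Set} {xs} → Any P xs → Any P (sort xs)
Any-sort {xs = xs} = Any-resp-↭ (↭-sym (sort-↭ xs))

sort-++ : ∀ xs ys → All (λ x → All (x ≤ᴵ_) ys) xs → sort (xs ++ ys) ≡ sort xs ++ sort ys
sort-++ xs ys xs≤ys = sorted-unique (sort-↗ (xs ++ ys))
  (AllPairs⇒Sorted totalOrder (AllPairs.++⁺ (Sorted⇒AllPairs totalOrder (sort-↗ xs))
                                            (Sorted⇒AllPairs totalOrder (sort-↗ ys))
                                            (All-sort (All.map All-sort xs≤ys))))
  (↭-trans (sort-↭ (xs ++ ys)) (Perm.++⁺ (↭-sym (sort-↭ xs)) (↭-sym (sort-↭ ys))))

sort-nonEmpty : ∀ {xs : List Item} → NonEmpty xs → NonEmpty (sort xs)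
sort-nonEmpty {[]}    ne _ = ne refl
sort-nonEmpty {x ∷ xs} _ e = ¬x∷xs↭[] (↭-sym (subst (_↭ x ∷ xs) e (sort-↭ (x ∷ xs))))

-- Keys are shifted by one: the key of a label y is suc y, that of a tree is suc of its
-- least label, and 0 stands for "no label" and is the neutral element of _⊓ₖ_.
infixl 7 _⊓ₖ_
_⊓ₖ_ : ℕ → ℕ → ℕ
zero  ⊓ₖ b     = b
suc a ⊓ₖ zero  = suc a
suc a ⊓ₖ suc b = suc (a ⊓ b)

⊓ₖ-comm : ∀ a b → a ⊓ₖ b ≡ b ⊓ₖ a
⊓ₖ-comm zero    zero    = refl
⊓ₖ-comm zero    (suc b) = refl
⊓ₖ-comm (suc a) zero    = refl
⊓ₖ-comm (suc a) (suc b) = cong suc (⊓-comm a b)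

⊓ₖ-assoc : ∀ a b c → a ⊓ₖ b ⊓ₖ c ≡ a ⊓ₖ (b ⊓ₖ c)
⊓ₖ-assoc zero    b       c       = refl
⊓ₖ-assoc (suc a) zero    c       = refl
⊓ₖ-assoc (suc a) (suc b) zero    = refl
⊓ₖ-assoc (suc a) (suc b) (suc c) = cong suc (⊓-assoc a b c)

⊓ₖ-swap : ∀ a b c → a ⊓ₖ (b ⊓ₖ c) ≡ b ⊓ₖ (a ⊓ₖ c)
⊓ₖ-swap a b c = trans (sym (⊓ₖ-assoc a b c)) (trans (cong (_⊓ₖ c) (⊓ₖ-comm a b)) (⊓ₖ-assoc b a c))

⊓ₖ-lub : ∀ {a b n} → a ≤ n → b ≤ n → a ⊓ₖ b ≤ n
⊓ₖ-lub {zero}                  _         b≤n = b≤n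
⊓ₖ-lub {suc a} {zero}          a≤n       _   = a≤n
⊓ₖ-lub {suc a} {suc b} (s≤s a≤n) _           = s≤s (≤-trans (m⊓n≤m a b) a≤n)

⊓ₖ-sel : ∀ a b → a ⊓ₖ b ≡ a ⊎ a ⊓ₖ b ≡ b
⊓ₖ-sel zero    b       = inj₂ refl
⊓ₖ-sel (suc a) zero    = inj₁ refl
⊓ₖ-sel (suc a) (suc b) with ⊓-sel a b
... | inj₁ e = inj₁ (cong suc e)
... | inj₂ e = inj₂ (cong suc e)

⊓ₖ-zero : ∀ {a b} → a ⊓ₖ b ≡ 0 → a ≡ 0 × b ≡ 0
⊓ₖ-zero {zero}  {zero}  _  = refl , refl
⊓ₖ-zero {zero}  {suc _} ()
⊓ₖ-zero {suc _} {zero}  ()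
⊓ₖ-zero {suc _} {suc _} ()

labelsKey : List ℕ → ℕ
labelsKey []      = 0
labelsKey (y ∷ L) = suc y ⊓ₖ labelsKey L

mutual
  treeKey : RW → ℕ
  treeKey (nd L cs) = labelsKey L ⊓ₖ forestKey cs

  forestKey : List RW → ℕ
  forestKey []       = 0
  forestKey (c ∷ cs) = treeKey c ⊓ₖ forestKey cs

forestKey-++ : ∀ xs ys → forestKey (xs ++ ys) ≡ forestKey xs ⊓ₖ forestKey ys
forestKey-++ []       ys = refl
forestKey-++ (x ∷ xs) ys = trans (cong (treeKey x ⊓ₖ_) (forestKey-++ xs ys)) (sym (⊓ₖ-assoc (treeKey x) _ _))

labelsKey-↭ : ∀ {L L′} → L ↭ L′ → labelsKey L ≡ labelsKey L′
labelsKey-↭ ↭.refl                   = refl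
labelsKey-↭ (↭.prep x p)             = cong (suc x ⊓ₖ_) (labelsKey-↭ p)
labelsKey-↭ {x ∷ y ∷ _} {_ ∷ _ ∷ ys} (↭.swap x y p) =
  trans (cong (λ k → suc x ⊓ₖ (suc y ⊓ₖ k)) (labelsKey-↭ p)) (⊓ₖ-swap (suc x) (suc y) (labelsKey ys))
labelsKey-↭ (↭.trans p q)            = trans (labelsKey-↭ p) (labelsKey-↭ q)

mutual
  treeKey-≈ : ∀ {s t} → s ≈T t → treeKey s ≡ treeKey t
  treeKey-≈ (nd≈ p q) = cong₂ _⊓ₖ_ (labelsKey-↭ p) (forestKey-≈ q)

  forestKey-≈ : ∀ {s t} → s ≈F t → forestKey s ≡ forestKey t
  forestKey-≈ []≈                   = refl
  forestKey-≈ (∷≈ p q)              = cong₂ _⊓ₖ_ (treeKey-≈ p) (forestKey-≈ q)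
  forestKey-≈ (swap≈ {t} {t′} {ts}) = ⊓ₖ-swap (treeKey t) (treeKey t′) (forestKey ts)
  forestKey-≈ (trans≈ p q)          = trans (forestKey-≈ p) (forestKey-≈ q)

labelsKey-≤ : ∀ {m L} → All (_≤ m) L → labelsKey L ≤ suc m
labelsKey-≤ []       = z≤n
labelsKey-≤ (p ∷ ps) = ⊓ₖ-lub (s≤s p) (labelsKey-≤ ps)

mutual
  treeKey-≤ : ∀ {m} t → AllLabels (_≤ m) t → treeKey t ≤ suc m
  treeKey-≤ (nd L cs) (p , q) = ⊓ₖ-lub (labelsKey-≤ p) (forestKey-≤ cs q)

  forestKey-≤ : ∀ {m} cs → AllLabelsF (_≤ m) cs → forestKey cs ≤ suc m
  forestKey-≤ []       tt      = z≤n
  forestKey-≤ (c ∷ cs) (p , q) = ⊓ₖ-lub (treeKey-≤ c p) (forestKey-≤ cs q)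

labelsKey-attained : ∀ {P : ℕ → Set} {L} → All P L → ∀ {y} → labelsKey L ≡ suc y → P y
labelsKey-attained {L = x ∷ L} (p ∷ ps) e with ⊓ₖ-sel (suc x) (labelsKey L)
... | inj₁ e′ = subst _ (suc-injective (trans (sym e′) e)) p
... | inj₂ e′ = labelsKey-attained ps (trans (sym e′) e)

mutual
  treeKey-attained : ∀ {P : ℕ → Set} t → AllLabels P t → ∀ {y} → treeKey t ≡ suc y → P y
  treeKey-attained (nd L cs) (p , q) e with ⊓ₖ-sel (labelsKey L) (forestKey cs)
  ... | inj₁ e′ = labelsKey-attained p (trans (sym e′) e)
  ... | inj₂ e′ = forestKey-attained cs q (trans (sym e′) e)

  forestKey-attained : ∀ {P : ℕ → Set} cs → AllLabelsF P cs → ∀ {y} → forestKey cs ≡ suc y → P y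
  forestKey-attained (c ∷ cs) (p , q) e with ⊓ₖ-sel (treeKey c) (forestKey cs)
  ... | inj₁ e′ = treeKey-attained c p (trans (sym e′) e)
  ... | inj₂ e′ = forestKey-attained cs q (trans (sym e′) e)

treeKey-> : ∀ {m} t → AllLabels (m <_) t → treeKey t ≢ 0 → suc m < treeKey t
treeKey-> t h nz with treeKey t in e
... | zero  = contradiction refl nz
... | suc y = s≤s (treeKey-attained t h e)

mutual
  Labelled : RW → Set
  Labelled (nd L cs) = treeKey (nd L cs) ≢ 0 × LabelledF cs

  LabelledF : List RW → Set
  LabelledF []       = ⊤
  LabelledF (c ∷ cs) = Labelled c × LabelledF cs

Labelled⇒treeKey≢0 : ∀ t → Labelled t → treeKey t ≢ 0
Labelled⇒treeKey≢0 (nd L cs) (p , _) = p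

LabelledF-++ : ∀ xs ys → LabelledF xs → LabelledF ys → LabelledF (xs ++ ys)
LabelledF-++ []       ys p        q = q
LabelledF-++ (x ∷ xs) ys (p , ps) q = p , LabelledF-++ xs ys ps q

LabelledF-factors : ∀ t → Labelled t → LabelledF (factors t)
LabelledF-factors t l with red t
LabelledF-factors (nd L cs) l | true  = proj₂ l
LabelledF-factors (nd L cs) l | false = l , tt

forestKey≢0 : ∀ xs → LabelledF xs → NonEmpty xs → forestKey xs ≢ 0
forestKey≢0 []       _       ne = contradiction refl ne
forestKey≢0 (x ∷ xs) (l , _) _  = λ e → Labelled⇒treeKey≢0 x l (proj₁ (⊓ₖ-zero e))

Labelled-nd : ∀ L E R → LabelledF E → LabelledF R → NonEmpty E → Labelled (nd L (E ++ R))
Labelled-nd L E R lE lR ne =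
  (λ e → forestKey≢0 E lE ne (proj₁ (⊓ₖ-zero (trans (sym (forestKey-++ E R)) (proj₂ (⊓ₖ-zero e)))))) ,
  LabelledF-++ E R lE lR

Labelled-hang : ∀ X E → Labelled X → LabelledF E → NonEmpty E → Labelled (hang X E)
Labelled-hang X E l lE ne with red X
Labelled-hang (nd L cs) E l lE ne | true  = Labelled-nd [] E (nd L cs ∷ []) lE (l , tt) ne
Labelled-hang (nd L cs) E l lE ne | false = Labelled-nd L E cs lE (proj₂ l) ne

Labelled-evOp : ∀ o A Y → Labelled A → Labelled Y → NonEmpty (factors A) → NonEmpty (factors Y) →
                Labelled (evOp o A Y)
Labelled-evOp prec A Y lA lY nA nY = Labelled-hang A (factors Y) lA (LabelledF-factors Y lY) nY
Labelled-evOp succ A Y lA lY nA nY = Labelled-hang Y (factors A) lY (LabelledF-factors A lA) nA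
Labelled-evOp odot A Y lA lY nA nY =
  Labelled-nd [] (factors A) (factors Y) (LabelledF-factors A lA) (LabelledF-factors Y lY) nA
Labelled-evOp circ A Y lA lY nA nY = Labelled-evOp odot A Y lA lY nA nY

labelsKey-map-zero : ∀ f L → labelsKey (map f L) ≡ 0 → labelsKey L ≡ 0
labelsKey-map-zero f []      _ = refl
labelsKey-map-zero f (y ∷ L) e with () ← proj₁ (⊓ₖ-zero {suc (f y)} {labelsKey (map f L)} e)

mutual
  treeKey-relabel-zero : ∀ f t → treeKey (relabel f t) ≡ 0 → treeKey t ≡ 0
  treeKey-relabel-zero f (nd L cs) e with ⊓ₖ-zero {labelsKey (map f L)} e
  ... | e₁ , e₂ rewrite labelsKey-map-zero f L e₁ | forestKey-relabel-zero f cs e₂ = refl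

  forestKey-relabel-zero : ∀ f cs → forestKey (relabelF f cs) ≡ 0 → forestKey cs ≡ 0
  forestKey-relabel-zero f []       _ = refl
  forestKey-relabel-zero f (c ∷ cs) e with ⊓ₖ-zero {treeKey (relabel f c)} e
  ... | e₁ , e₂ rewrite treeKey-relabel-zero f c e₁ | forestKey-relabel-zero f cs e₂ = refl

mutual
  Labelled-relabel : ∀ f t → Labelled t → Labelled (relabel f t)
  Labelled-relabel f (nd L cs) (p , q) = (λ e → p (treeKey-relabel-zero f (nd L cs) e)) , LabelledF-relabel f cs q

  LabelledF-relabel : ∀ f cs → LabelledF cs → LabelledF (relabelF f cs)
  LabelledF-relabel f []       tt      = tt
  LabelledF-relabel f (c ∷ cs) (p , q) = Labelled-relabel f c p , LabelledF-relabel f cs q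

Labelled-toTree : ∀ a → Labelled (toTree a)
Labelled-toTree leaf         = (λ ()) , tt
Labelled-toTree (node o a b) =
  Labelled-evOp o (toTree a) (shift (ar a) (toTree b)) (Labelled-toTree a)
    (Labelled-relabel _ (toTree b) (Labelled-toTree b))
    (factors-toTree-nonEmpty a) (factors-relabel-nonEmpty _ (toTree b) (factors-toTree-nonEmpty b))

-- Reading a tree back into a term

labelItem : ℕ → Item
labelItem y = item (suc y) true leaf

product : List Item → Tm
product []           = leaf
product (x ∷ [])     = term x
product (x ∷ y ∷ xs) = term x ⊙ₙ product (y ∷ xs)

whiteTerm : List Item → Tm
whiteTerm []                          = leaf
whiteTerm (item _ false t ∷ xs)       = t ≻ₙ whiteTerm xs
whiteTerm (item _ true  t ∷ [])       = t
whiteTerm (item _ true  t ∷ y ∷ xs)   = t ≺ₙ product (y ∷ xs)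

mutual
  decode : RW → Tm
  decode (nd L cs) = if red (nd L cs) then product (sort (map labelItem L ++ childItems cs))
                                      else whiteTerm (sort (map labelItem L ++ childItems cs))

  childItems : List RW → List Item
  childItems []       = []
  childItems (c ∷ cs) = item (treeKey c) (red c) (decode c) ∷ childItems cs

mutual
  decode-≈ : ∀ {s t} → s ≈T t → decode s ≡ decode t
  decode-≈ (nd≈ p q) =
    cong₂ (λ r xs → if r then product xs else whiteTerm xs) (red-≈ (nd≈ p q))
          (sort-resp-↭ (Perm.++⁺ (Perm.map⁺ labelItem p) (childItems-≈ q)))

  childItems-≈ : ∀ {s t} → s ≈F t → childItems s ↭ childItems t
  childItems-≈ []≈          = ↭.refl
  childItems-≈ (∷≈ p q) rewrite treeKey-≈ p | red-≈ p | decode-≈ p = ↭.prep _ (childItems-≈ q)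
  childItems-≈ swap≈        = ↭.swap _ _ ↭.refl
  childItems-≈ (trans≈ p q) = ↭.trans (childItems-≈ p) (childItems-≈ q)

IsPivot : Item → Set
IsPivot x = pivot x ≡ true

product-++ : ∀ xs ys → NonEmpty xs → NonEmpty ys → product (xs ++ ys) ≡ product xs ⊙ₙ product ys
product-++ []           ys       ne _  = contradiction refl ne
product-++ (x ∷ [])     []       _  ne = contradiction refl ne
product-++ (x ∷ [])     (y ∷ ys) _  _  = refl
product-++ (x ∷ x′ ∷ xs) ys      _  ne =
  trans (cong (term x ⊙ₙ_) (product-++ (x′ ∷ xs) ys (λ ()) ne)) (sym (⊙ₙ-assoc (term x) _ _))

whiteTerm-++ : ∀ xs ys → Any IsPivot xs → NonEmpty ys → whiteTerm (xs ++ ys) ≡ whiteTerm xs ≺ₙ product ys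
whiteTerm-++ (item _ false _ ∷ xs)     ys       (here ())  _
whiteTerm-++ (item _ false t ∷ xs)     ys       (there p)  ne =
  trans (cong (t ≻ₙ_) (whiteTerm-++ xs ys p ne)) (sym (≻ₙ-≺ₙ t (whiteTerm xs) (product ys)))
whiteTerm-++ (item _ true  t ∷ [])     []       _          ne = contradiction refl ne
whiteTerm-++ (item _ true  t ∷ [])     (y ∷ ys) _          _  = refl
whiteTerm-++ (item _ true  t ∷ x ∷ xs) ys       _          ne =
  trans (cong (t ≺ₙ_) (product-++ (x ∷ xs) ys (λ ()) ne)) (sym (≺ₙ-≺ₙ t _ _))

whiteTerm-++-nonPivots : ∀ xs ys → All (λ x → pivot x ≡ false) xs → NonEmpty xs →
                         whiteTerm (xs ++ ys) ≡ product xs ≻ₙ whiteTerm ys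
whiteTerm-++-nonPivots []                         ys _             ne = contradiction refl ne
whiteTerm-++-nonPivots (item _ false t ∷ [])      ys (refl ∷ _)    _  = refl
whiteTerm-++-nonPivots (item _ false t ∷ x ∷ xs)  ys (refl ∷ ps)   _  =
  trans (cong (t ≻ₙ_) (whiteTerm-++-nonPivots (x ∷ xs) ys ps (λ ()))) (sym (⊙ₙ-≻ₙ t _ _))

items : RW → List Item
items t = map labelItem (labels t) ++ childItems (children t)

childItems-++ : ∀ xs ys → childItems (xs ++ ys) ≡ childItems xs ++ childItems ys
childItems-++ []       ys = refl
childItems-++ (x ∷ xs) ys = cong (_ ∷_) (childItems-++ xs ys)

childItems-nonEmpty : ∀ cs → NonEmpty cs → NonEmpty (childItems cs)
childItems-nonEmpty []      ne = contradiction refl ne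
childItems-nonEmpty (_ ∷ _) _  = λ ()

decode-white : ∀ t → red t ≡ false → decode t ≡ whiteTerm (sort (items t))
decode-white (nd L cs) e rewrite e = refl

product-factors : ∀ X → product (sort (childItems (factors X))) ≡ decode X
product-factors (nd [] cs) with allWhite cs in e
... | true  = refl
... | false rewrite e = refl
product-factors (nd (_ ∷ _) cs) = refl

nonPivots : ∀ cs → allWhite cs ≡ true → All (λ x → pivot x ≡ false) (childItems cs)
nonPivots []       _ = []
nonPivots (c ∷ cs) e with red c
... | false = refl ∷ nonPivots cs e

nonPivots-factors : ∀ X → All (λ x → pivot x ≡ false) (childItems (factors X))
nonPivots-factors X = nonPivots (factors X) (allWhite-factors X)

pivot-redChild : ∀ cs → allWhite cs ≡ false → Any IsPivot (childItems cs)
pivot-redChild (c ∷ cs) e with red c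
... | true  = here refl
... | false = there (pivot-redChild cs e)

pivot-white : ∀ t → red t ≡ false → Any IsPivot (items t)
pivot-white (nd []      cs) e = pivot-redChild cs e
pivot-white (nd (_ ∷ _) cs) e = here refl

-- The items a tree X contributes to the root of hang X E.
rootItems : RW → List Item
rootItems X = if red X then item (treeKey X) true (decode X) ∷ [] else items X

items-hang : ∀ X E → items (hang X E) ↭ childItems E ++ rootItems X
items-hang X E with red X in e
... | true  rewrite childItems-++ E (X ∷ []) | e = ↭.refl
... | false rewrite childItems-++ E (children X) = shifts (map labelItem (labels X)) (childItems E)

whiteTerm-rootItems : ∀ X → whiteTerm (sort (rootItems X)) ≡ decode X
whiteTerm-rootItems X with red X in e
... | true  = refl
... | false = sym (decode-white X e)

pivot-rootItems : ∀ X → Any IsPivot (sort (rootItems X))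
pivot-rootItems X with red X in e
... | true  = here refl
... | false = Any-sort (pivot-white X e)

KeyAtMost : ℕ → Item → Set
KeyAtMost m x = key x ≤ suc m

KeyAbove : ℕ → Item → Set
KeyAbove m x = suc m < key x

separated : ∀ {m xs ys} → All (KeyAtMost m) xs → All (KeyAbove m) ys → All (λ x → All (x ≤ᴵ_) ys) xs
separated xs≤ ys> = All.map (λ x≤ → All.map (λ >y → key<⇒≤ᴵ (≤-<-trans x≤ >y)) ys>) xs≤

labelItems-atMost : ∀ {m L} → All (_≤ m) L → All (KeyAtMost m) (map labelItem L)
labelItems-atMost p = All.map⁺ (All.map s≤s p)

labelItems-above : ∀ {m L} → All (m <_) L → All (KeyAbove m) (map labelItem L)
labelItems-above p = All.map⁺ (All.map s≤s p)

childItems-atMost : ∀ {m} cs → AllLabelsF (_≤ m) cs → All (KeyAtMost m) (childItems cs)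
childItems-atMost []       _       = []
childItems-atMost (c ∷ cs) (p , q) = treeKey-≤ c p ∷ childItems-atMost cs q

childItems-above : ∀ {m} cs → AllLabelsF (m <_) cs → LabelledF cs → All (KeyAbove m) (childItems cs)
childItems-above []       _       _       = []
childItems-above (c ∷ cs) (p , q) (l , k) = treeKey-> c p (Labelled⇒treeKey≢0 c l) ∷ childItems-above cs q k

rootItems-atMost : ∀ {m} X → AllLabels (_≤ m) X → All (KeyAtMost m) (rootItems X)
rootItems-atMost X h with red X
rootItems-atMost X         h       | true  = treeKey-≤ X h ∷ []
rootItems-atMost (nd L cs) (p , q) | false = All.++⁺ (labelItems-atMost p) (childItems-atMost cs q)

rootItems-above : ∀ {m} X → AllLabels (m <_) X → Labelled X → All (KeyAbove m) (rootItems X)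
rootItems-above X h l with red X
rootItems-above X         h       l       | true  = treeKey-> X h (Labelled⇒treeKey≢0 X l) ∷ []
rootItems-above (nd L cs) (p , q) (_ , k) | false = All.++⁺ (labelItems-above p) (childItems-above cs q k)

decode-red : ∀ t → red t ≡ true → decode t ≡ product (sort (items t))
decode-red (nd L cs) e rewrite e = refl

red-join : ∀ A Y → red (join A Y) ≡ true
red-join A Y rewrite allWhite-++ (factors A) (factors Y) | allWhite-factors A | allWhite-factors Y = refl

module _ {m : ℕ} {A Y : RW} (A≤m : AllLabels (_≤ m) A) (m<Y : AllLabels (m <_) Y) (lY : Labelled Y) where

  private
    IA = childItems (factors A)
    IY = childItems (factors Y)

    IA-atMost : All (KeyAtMost m) IA
    IA-atMost = childItems-atMost (factors A) (AllLabelsF-factors A A≤m)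

    IY-above : All (KeyAbove m) IY
    IY-above = childItems-above (factors Y) (AllLabelsF-factors Y m<Y) (LabelledF-factors Y lY)

  decode-hang-≺ : NonEmpty (factors Y) → decode (hang A (factors Y)) ≡ decode A ≺ₙ decode Y
  decode-hang-≺ ne = begin
      decode (hang A (factors Y))
    ≡⟨ decode-white (hang A (factors Y)) (white-hang A (factors Y)) ⟩
      whiteTerm (sort (items (hang A (factors Y))))
    ≡⟨ cong whiteTerm (sort-resp-↭ (↭-trans (items-hang A (factors Y)) (++-comm IY (rootItems A)))) ⟩
      whiteTerm (sort (rootItems A ++ IY))
    ≡⟨ cong whiteTerm (sort-++ (rootItems A) IY (separated (rootItems-atMost A A≤m) IY-above)) ⟩
      whiteTerm (sort (rootItems A) ++ sort IY)
    ≡⟨ whiteTerm-++ (sort (rootItems A)) (sort IY) (pivot-rootItems A) (sort-nonEmpty (childItems-nonEmpty _ ne)) ⟩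
      whiteTerm (sort (rootItems A)) ≺ₙ product (sort IY)
    ≡⟨ cong₂ _≺ₙ_ (whiteTerm-rootItems A) (product-factors Y) ⟩
      decode A ≺ₙ decode Y
    ∎
    where open ≡-Reasoning

  decode-hang-≻ : NonEmpty (factors A) → decode (hang Y (factors A)) ≡ decode A ≻ₙ decode Y
  decode-hang-≻ ne = begin
      decode (hang Y (factors A))
    ≡⟨ decode-white (hang Y (factors A)) (white-hang Y (factors A)) ⟩
      whiteTerm (sort (items (hang Y (factors A))))
    ≡⟨ cong whiteTerm (sort-resp-↭ (items-hang Y (factors A))) ⟩
      whiteTerm (sort (IA ++ rootItems Y))
    ≡⟨ cong whiteTerm (sort-++ IA (rootItems Y) (separated IA-atMost (rootItems-above Y m<Y lY))) ⟩
      whiteTerm (sort IA ++ sort (rootItems Y))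
    ≡⟨ whiteTerm-++-nonPivots (sort IA) (sort (rootItems Y)) (All-sort (nonPivots-factors A))
                              (sort-nonEmpty (childItems-nonEmpty _ ne)) ⟩
      product (sort IA) ≻ₙ whiteTerm (sort (rootItems Y))
    ≡⟨ cong₂ _≻ₙ_ (product-factors A) (whiteTerm-rootItems Y) ⟩
      decode A ≻ₙ decode Y
    ∎
    where open ≡-Reasoning

  decode-join : NonEmpty (factors A) → NonEmpty (factors Y) → decode (join A Y) ≡ decode A ⊙ₙ decode Y
  decode-join neA neY = begin
      decode (join A Y)
    ≡⟨ decode-red (join A Y) (red-join A Y) ⟩
      product (sort (childItems (factors A ++ factors Y)))
    ≡⟨ cong (λ xs → product (sort xs)) (childItems-++ (factors A) (factors Y)) ⟩
      product (sort (IA ++ IY))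
    ≡⟨ cong product (sort-++ IA IY (separated IA-atMost IY-above)) ⟩
      product (sort IA ++ sort IY)
    ≡⟨ product-++ (sort IA) (sort IY) (sort-nonEmpty (childItems-nonEmpty _ neA))
                                      (sort-nonEmpty (childItems-nonEmpty _ neY)) ⟩
      product (sort IA) ⊙ₙ product (sort IY)
    ≡⟨ cong₂ _⊙ₙ_ (product-factors A) (product-factors Y) ⟩
      decode A ⊙ₙ decode Y
    ∎
    where open ≡-Reasoning

  decode-evOp : ∀ o → o ≢ circ → NonEmpty (factors A) → NonEmpty (factors Y) →
                decode (evOp o A Y) ≡ opₙ o (decode A) (decode Y)
  decode-evOp prec _ _  neY = decode-hang-≺ neY
  decode-evOp succ _ neA _  = decode-hang-≻ neA
  decode-evOp odot _ neA neY = decode-join neA neY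
  decode-evOp circ o≢circ _ _ = contradiction refl o≢circ

decode-shift-toTree : ∀ a w → circFree a ≡ true → decode (shift w (toTree a)) ≡ normalise a
decode-shift-toTree leaf         w _ = refl
decode-shift-toTree (node o a b) w h = begin
    decode (shift w (evOp o (toTree a) (shift (ar a) (toTree b))))
  ≡⟨ cong decode (trans (evOp-relabel o (λ y → y + w) (toTree a) (shift (ar a) (toTree b)))
                        (cong (evOp o A) (shift-shift w (ar a) (toTree b)))) ⟩
    decode (evOp o A Y)
  ≡⟨ decode-evOp A≤m m<Y (Labelled-relabel _ (toTree b) (Labelled-toTree b)) o (circFree⇒≢circ h)
                 (factors-relabel-nonEmpty _ (toTree a) (factors-toTree-nonEmpty a))
                 (factors-relabel-nonEmpty _ (toTree b) (factors-toTree-nonEmpty b)) ⟩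
    opₙ o (decode A) (decode Y)
  ≡⟨ cong₂ (opₙ o) (decode-shift-toTree a w (circFreeˡ o a b h))
                   (decode-shift-toTree b (w + ar a) (circFreeʳ o a b h)) ⟩
    opₙ o (normalise a) (normalise b)
  ∎
  where
  open ≡-Reasoning
  m = w + ar a
  A = shift w (toTree a)
  Y = shift m (toTree b)
  A≤m : AllLabels (_≤ m) A
  A≤m = AllLabels-relabel (λ y → y + w) (toTree a)
          (AllLabels-map (λ {y} y≤a → subst (y + w ≤_) (+-comm (ar a) w) (+-monoˡ-≤ w y≤a)) (toTree a) (bounded a))
  m<Y : AllLabels (m <_) Y
  m<Y = AllLabels-relabel (λ y → y + m) (toTree b) (AllLabels-map (+-monoˡ-≤ m) (toTree b) (positive b))

-- The isomorphism

termOf : ∀ {n S} → GenB n S → Tm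
termOf b-unit                      = leaf
termOf b-gen₁                      = node succ leaf leaf
termOf b-gen₂                      = node prec leaf leaf
termOf b-gen₃                      = node odot leaf leaf
termOf (b-comp {i = i} dS dT _ _)  = termOf dS ∘⟨ i ⟩ termOf dT

GenG-termOf : ∀ {n S} (d : GenB n S) → GenG n (termOf d)
GenG-termOf b-unit             = g-unit
GenG-termOf b-gen₁             = g-succ
GenG-termOf b-gen₂             = g-prec
GenG-termOf b-gen₃             = g-odot
GenG-termOf (b-comp dS dT p q) = g-comp (GenG-termOf dS) (GenG-termOf dT) p q

ar-GenG : ∀ {n a} → GenG n a → ar a ≡ n
ar-GenG g-unit = refl
ar-GenG g-prec = refl
ar-GenG g-odot = refl
ar-GenG g-succ = refl
ar-GenG (g-comp {a = a} {b} {i} ga gb p q) =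
  trans (ar-∘⟨⟩ a b i p (subst (i ≤_) (sym (ar-GenG ga)) q)) (cong₂ (λ m n → m + n ∸ 1) (ar-GenG ga) (ar-GenG gb))

toTree-termOf : ∀ {n S} (d : GenB n S) → toTree (termOf d) ≡ S
toTree-termOf b-unit = refl
toTree-termOf b-gen₁ = refl
toTree-termOf b-gen₂ = refl
toTree-termOf b-gen₃ = refl
toTree-termOf (b-comp {i = i} dS dT p q) =
  trans (toTree-∘⟨⟩ (termOf dS) (termOf dT) i p (subst (i ≤_) (sym (ar-GenG (GenG-termOf dS))) q))
        (cong₂ (λ S T → compRW S i T) (toTree-termOf dS) (toTree-termOf dT))

circFree-termOf : ∀ {n S} (d : GenB n S) → circFree (termOf d) ≡ true
circFree-termOf b-unit = refl
circFree-termOf b-gen₁ = refl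
circFree-termOf b-gen₂ = refl
circFree-termOf b-gen₃ = refl
circFree-termOf (b-comp {i = i} dS dT _ _) =
  circFree-∘⟨⟩ (termOf dS) (termOf dT) i (circFree-termOf dS) (circFree-termOf dT)

normalise-termOf : ∀ {n S} (d : GenB n S) → normalise (termOf d) ≡ decode S
normalise-termOf {S = S} d = trans (sym (decode-shift-toTree (termOf d) 0 (circFree-termOf d)))
                                   (cong decode (trans (shift-zero (toTree (termOf d))) (toTree-termOf d)))

termOf-surjective : ∀ {n a} → GenG n a → Σ RW λ S → Σ (GenB n S) λ d → termOf d ≡ a
termOf-surjective g-unit = _ , b-unit , refl
termOf-surjective g-prec = _ , b-gen₂ , refl
termOf-surjective g-odot = _ , b-gen₃ , refl
termOf-surjective g-succ = _ , b-gen₁ , refl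
termOf-surjective (g-comp {i = i} ga gb p q) with termOf-surjective ga | termOf-surjective gb
... | _ , dS , refl | _ , dT , refl = _ , b-comp dS dT p q , refl

φ : (n : ℕ) → BWS n → SubGR n
φ n (S , d) = termOf d , GenG-termOf d

mainTheorem13 : Σ ((n : ℕ) → BWS n → SubGR n) IsOperadIso
mainTheorem13 = φ , record
  { φ-cong = λ { n (S , dS) (T , dT) S≈T →
      ≋⇒~ (normalise-≡⇒≋ (trans (normalise-termOf dS) (trans (decode-≈ S≈T) (sym (normalise-termOf dT))))) }
  ; φ-inj  = λ { n (S , dS) (T , dT) φS~φT →
      subst₂ _≈T_ (toTree-termOf dS) (toTree-termOf dT) (toTree-resp-≋ (~⇒≋ φS~φT) (circFree-termOf dS)) }
  ; φ-surj = λ { n (a , ga) → let S , d , e = termOf-surjective ga in (S , d) , subst (termOf d ~_) e ~refl }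
  ; φ-unit = ~refl
  ; φ-comp = λ _ _ _ _ _ _ _ → ~refl
  }
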